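{- Let $G$ be an internally-triangulated primary $st$-outerpath. Then, for an ordering $\langle f_1,\dots,f_h\rangle$ of the inner faces of $G$ along the path $\overline{G}$ in which $f_1$ is an extreme face incident to $s$, $G$ admits an $st$-fan decomposition.
   Context: An $st$-DAG is a DAG with exactly one source $s$ and one sink $t$. An $st$-outerpath is an $st$-DAG whose underlying graph is an outerpath (outerplanar, with weak dual $\overline{G}$ — one node per inner face, adjacent when faces share an edge — being a path); here it is internally triangulated: biconnected with all inner faces triangles. The extreme faces are the two faces corresponding to the endpoints of the path $\overline{G}$; $G$ is primary if one extreme face is incident to $s$. Let $\langle f_1,\dots,f_h\rangle$ be the faces in order along $\overline{G}$. An $xy$-fan is an $xy$-DAG (single source $x$, single sink $y$) whose underlying graph is an internally-triangulated outerpath all of whose inner edges are incident to $x$ (a single triangle qualifies). A subgraph $F$ of $G$ formed by a set of consecutive faces $f_j,\dots,f_i$ that is an $xy$-fan is incrementally maximal if $i=h$ or $F\cup f_{i+1}$ is not an $xy$-fan. An $st$-fan decomposition of $G$ is a sequence $F_1,\dots,F_k$ of such subgraphs, $F_i$ an $s_it_i$-fan, such that: (i) each $F_i$ is incrementally maximal; (ii) for $j>i+1$, $F_i$ and $F_j$ share no edge, while $F_i$ and $F_{i+1}$ share exactly one edge, denoted $e_i$; (iii) $s_1=s$; (iv) the tail of $e_i$ is $s_{i+1}$; (v) $e_i\neq s_it_i$; (vi) $\bigcup_{i=1}^k F_i=G$. -}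

module Defs where

open import Data.Nat using (ℕ; zero; suc; _≤_; _<_)
open import Data.Fin using (Fin; toℕ)
open import Data.Fin.Subset using (Subset; _∈_; ∣_∣)
open import Data.Product using (Σ; ∃; ∃-syntax; _×_; _,_)
open import Data.Sum using (_⊎_)
open import Relation.Nullary using (¬_)
open import Relation.Binary.PropositionalEquality using (_≡_; _≢_)
open import Relation.Binary.Construct.Closure.Transitive using (TransClosure)
open import Relation.Binary.Construct.Closure.ReflexiveTransitive using (Star)
open import Function.Definitions using (Injective)

module _ {n : ℕ} (E : Fin n → Fin n → Set) where

  Adj : Fin n → Fin n → Set
  Adj u v = E u v ⊎ E v u

  -- no directed cycle (this also excludes loops and antiparallel pairs)
  Acyclic : Set
  Acyclic = ∀ v → ¬ TransClosure E v v

  IsSource : Fin n → Set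
  IsSource v = ∀ u → ¬ E u v

  IsSink : Fin n → Set
  IsSink v = ∀ w → ¬ E v w

  STDAG : Fin n → Fin n → Set
  STDAG s t = Acyclic
            × IsSource s × (∀ v → IsSource v → v ≡ s)
            × IsSink t × (∀ v → IsSink v → v ≡ t)

  AdjAvoid : Fin n → Fin n → Fin n → Set
  AdjAvoid w u v = Adj u v × u ≢ w × v ≢ w

  Connected : Set
  Connected = ∀ u v → Star Adj u v

  Biconnected : Set
  Biconnected = 3 ≤ n × Connected
              × (∀ w u v → u ≢ w → v ≢ w → Star (AdjAvoid w) u v)

-- Outerplanar drawings: vertices placed on a circle, at cyclic positions
-- 0 .. n-1 given by the injective map pos, edges drawn as straight chords
-- that pairwise do not cross.

-- ArcN a x b : position x lies strictly inside the clockwise open arc a → b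
ArcN : ℕ → ℕ → ℕ → Set
ArcN a x b = (a < x × x < b) ⊎ (b ≤ a × (a < x ⊎ x < b))

module _ {n : ℕ} (pos : Fin n → Fin n) where

  Arc : Fin n → Fin n → Fin n → Set
  Arc a x b = ArcN (toℕ (pos a)) (toℕ (pos x)) (toℕ (pos b))

  module _ (E : Fin n → Fin n → Set) where

    NonCrossing : Set
    NonCrossing = ∀ a b c d → Adj E a b → Adj E c d → ¬ (Arc a c b × Arc b d a)

    OuterplanarDrawing : Set
    OuterplanarDrawing = Injective _≡_ _≡_ pos × NonCrossing

    Consecutive : Subset n → Fin n → Fin n → Set
    Consecutive S u v = u ∈ S × v ∈ S × u ≢ v × (∀ x → x ∈ S → ¬ Arc u x v)

    -- S is (the vertex set of) an inner face of the drawing: the convex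
    -- polygon on S has all its sides as edges and no edge meets its interior
    -- (a chord uv meets the interior iff S has vertices strictly on both sides).
    IsInnerFace : Subset n → Set
    IsInnerFace S = 3 ≤ ∣ S ∣
                  × (∀ u v → Consecutive S u v → Adj E u v)
                  × (∀ u v → Adj E u v →
                       ¬ ((∃[ a ] (a ∈ S × Arc u a v)) × (∃[ b ] (b ∈ S × Arc v b u))))

    InternallyTriangulated : Set
    InternallyTriangulated = ∀ S → IsInnerFace S → ∣ S ∣ ≡ 3

    ShareEdge : Subset n → Subset n → Set
    ShareEdge S T = ∃[ u ] ∃[ v ] (E u v × u ∈ S × v ∈ S × u ∈ T × v ∈ T)

    -- f_0, ..., f_{h-1} lists all inner faces, without repetition, in the
    -- order along the weak dual, which is a path
    -- (f_i, f_j adjacent in the weak dual iff |i - j| = 1).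
    FaceOrdering : (h : ℕ) → (Fin h → Subset n) → Set
    FaceOrdering h f = (∀ i → IsInnerFace (f i))
                     × (∀ S → IsInnerFace S → ∃[ i ] (f i ≡ S))
                     × Injective _≡_ _≡_ f
                     × (∀ i j → i ≢ j → ShareEdge (f i) (f j) →
                          (toℕ i ≡ suc (toℕ j) ⊎ toℕ j ≡ suc (toℕ i)))
                     × (∀ i j → (toℕ i ≡ suc (toℕ j) ⊎ toℕ j ≡ suc (toℕ i)) →
                          ShareEdge (f i) (f j))

-- Subgraphs formed by consecutive faces f_a, ..., f_b (0-based indices).

module _ {n : ℕ} (E : Fin n → Fin n → Set) {h : ℕ} (f : Fin h → Subset n) where

  InRange : ℕ → ℕ → Fin h → Set
  InRange a b k = a ≤ toℕ k × toℕ k ≤ b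

  VertF : ℕ → ℕ → Fin n → Set
  VertF a b v = ∃[ k ] (InRange a b k × v ∈ f k)

  EdgeF : ℕ → ℕ → Fin n → Fin n → Set
  EdgeF a b u v = E u v × ∃[ k ] (InRange a b k × u ∈ f k × v ∈ f k)

  InnerEdgeF : ℕ → ℕ → Fin n → Fin n → Set
  InnerEdgeF a b u v = E u v × ∃[ k ] ∃[ k' ] (InRange a b k × InRange a b k' × k ≢ k'
                          × u ∈ f k × v ∈ f k × u ∈ f k' × v ∈ f k')

  -- the subgraph formed by f_a..f_b is an xy-fan: x its unique source, y its
  -- unique sink, all inner edges incident to x.  (Acyclicity and being an
  -- internally-triangulated outerpath with faces f_a..f_b are inherited from G.)
  IsFan : ℕ → ℕ → Fin n → Fin n → Set
  IsFan a b x y = VertF a b x × (∀ u → ¬ EdgeF a b u x)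
                × (∀ v → VertF a b v → (∀ u → ¬ EdgeF a b u v) → v ≡ x)
                × VertF a b y × (∀ w → ¬ EdgeF a b y w)
                × (∀ v → VertF a b v → (∀ w → ¬ EdgeF a b v w) → v ≡ y)
                × (∀ u v → InnerEdgeF a b u v → u ≡ x ⊎ v ≡ x)

  IncMax : ℕ → ℕ → Set
  IncMax a b = suc b ≡ h ⊎ ¬ (∃[ x ] ∃[ y ] IsFan a (suc b) x y)

  SharedExactly : ℕ → ℕ → ℕ → ℕ → Fin n → Fin n → Set
  SharedExactly a b c d u v = EdgeF a b u v × EdgeF c d u v
                            × (∀ u' v' → EdgeF a b u' v' → EdgeF c d u' v' → u' ≡ u × v' ≡ v)

  record FanDecomposition (s : Fin n) : Set where
    field
      k : ℕ
      lo hi : ℕ → ℕ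
      src snk : ℕ → Fin n
      lo≤hi : ∀ i → i < k → lo i ≤ hi i
      hi<h : ∀ i → i < k → hi i < h
      fan : ∀ i → i < k → IsFan (lo i) (hi i) (src i) (snk i)
      maximal : ∀ i → i < k → IncMax (lo i) (hi i)
      noShare : ∀ i j → j < k → suc i < j → ∀ u v →
                  ¬ (EdgeF (lo i) (hi i) u v × EdgeF (lo j) (hi j) u v)
      consecutive : ∀ i → suc i < k → ∃[ u ] ∃[ v ]
                      (SharedExactly (lo i) (hi i) (lo (suc i)) (hi (suc i)) u v
                       × u ≡ src (suc i) × ¬ (u ≡ src i × v ≡ snk i))
      nonEmpty : 0 < k
      firstSrc : src 0 ≡ s
      coverV : ∀ v → ∃[ i ] (i < k × VertF (lo i) (hi i) v)
      coverE : ∀ u v → E u v → ∃[ i ] (i < k × EdgeF (lo i) (hi i) u v)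

module Submission where

-- Order the faces f₀, f₁, … along the dual path and cut them greedily into maximal fans.
-- Consecutive faces f_k, f_{k+1} share exactly one edge u → v, their third vertices lie on
-- opposite sides of it, and these hinge edges nest, so the faces containing a vertex form an
-- interval.  Since s lies in f₀ and is the only source, s is also the only source of every
-- prefix f₀ … f_k; hence the third vertex r of f_{k+1} never has an edge r → u.  Consequently
-- a fan starting at f_{k+1} has source u, the tail of the shared edge, and a maximal fan ending
-- at f_k cannot have u as source and v as sink, for then u → r and it would extend by f_{k+1}.
-- Every edge lies on a face because the graph is biconnected: the vertices on the far side of a
-- chord pq that are not hidden beneath another chord span a face.

open import Data.Nat using (ℕ; zero; suc; _≤_; _<_; _+_; _∸_; z≤n; s≤s; s≤s⁻¹; _≤?_; _<?_)
open import Data.Nat.Properties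
open import Data.Fin using (Fin; zero; suc; toℕ; fromℕ<)
import Data.Fin as Fin
import Data.Fin.Properties as Fin
open import Data.Fin.Properties using (any?; all?)
open import Data.Fin.Subset using (Subset; _∈_; _∉_; _⊆_; ∣_∣; inside; outside; Nonempty) renaming (⊥ to ∅)
open import Data.Fin.Subset.Properties using (∉⊥; ⊆-antisym; _∈?_)
open import Data.Vec using (_∷_; here; there; tabulate)
open import Data.Vec.Properties using (lookup⇒[]=; []=⇒lookup; lookup∘tabulate)
open import Data.List using (allFin; filter)
open import Data.List.Extrema.Nat using (argmax; argmax-all; f[xs]≤f[argmax])
open import Data.List.Membership.Propositional.Properties using (∈-filter⁺; ∈-allFin)
import Data.List.Relation.Unary.All as All
open import Data.List.Relation.Unary.All.Properties using (all-filter)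
open import Data.Product using (∃-syntax; _×_; _,_; proj₁; proj₂)
open import Data.Sum using (_⊎_; inj₁; inj₂)
open import Data.Empty using (⊥; ⊥-elim)
open import Function using (_∘_)
open import Level using (Level)
open import Relation.Nullary using (¬_; Dec; yes; no; does)
open import Relation.Nullary.Decidable using (dec-true; _×-dec_; _⊎-dec_; ¬?; _→-dec_; ¬¬-excluded-middle)
open import Relation.Unary using (Pred; Decidable)
open import Relation.Binary using (tri<; tri≈; tri>)
open import Relation.Binary.PropositionalEquality using (_≡_; _≢_; refl; cong; sym; trans; subst)
open import Relation.Binary.Construct.Closure.Transitive using ([_]; _∷_)
open import Relation.Binary.Construct.Closure.ReflexiveTransitive using (Star; ε; _◅_; fold)
open import Defs

private
  variable
    ℓ₁ : Level
    n : ℕ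

module Subsets where

  private
    variable
      k : ℕ
      S : Subset n
      x y a b c : Fin n

  remove : Fin n → Subset n → Subset n
  remove zero    (_ ∷ S) = outside ∷ S
  remove (suc x) (b ∷ S) = b ∷ remove x S

  ∣S∣≡1+∣remove∣ : x ∈ S → ∣ S ∣ ≡ suc ∣ remove x S ∣
  ∣S∣≡1+∣remove∣ {x = zero}  here = refl
  ∣S∣≡1+∣remove∣ {x = suc x} {inside ∷ S}  (there x∈S) = cong suc (∣S∣≡1+∣remove∣ x∈S)
  ∣S∣≡1+∣remove∣ {x = suc x} {outside ∷ S} (there x∈S) = ∣S∣≡1+∣remove∣ x∈S

  ∈-remove⁺ : y ∈ S → y ≢ x → y ∈ remove x S
  ∈-remove⁺ {y = zero}  {x = zero}  _           y≢x = ⊥-elim (y≢x refl)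
  ∈-remove⁺ {y = zero}  {x = suc x} here        _   = here
  ∈-remove⁺ {y = suc y} {x = zero}  (there y∈S) _   = there y∈S
  ∈-remove⁺ {y = suc y} {x = suc x} (there y∈S) y≢x = there (∈-remove⁺ y∈S (y≢x ∘ cong suc))

  ∈-remove⁻ : y ∈ remove x S → y ∈ S × y ≢ x
  ∈-remove⁻ {y = zero}  {x = zero}  {_ ∷ S} ()
  ∈-remove⁻ {y = zero}  {x = suc x} {_ ∷ S} here        = here , λ ()
  ∈-remove⁻ {y = suc y} {x = zero}  {_ ∷ S} (there y∈S) = there y∈S , λ ()
  ∈-remove⁻ {y = suc y} {x = suc x} {_ ∷ S} (there y∈S) =
    let y∈S′ , y≢x = ∈-remove⁻ y∈S in there y∈S′ , y≢x ∘ Fin.suc-injective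

  ∣S∣≡1+k⇒∣remove∣≡k : x ∈ S → ∣ S ∣ ≡ suc k → ∣ remove x S ∣ ≡ k
  ∣S∣≡1+k⇒∣remove∣≡k x∈S e = suc-injective (trans (sym (∣S∣≡1+∣remove∣ x∈S)) e)

  ∣S∣≡0⇒∉ : ∣ S ∣ ≡ 0 → x ∉ S
  ∣S∣≡0⇒∉ {S = inside  ∷ S} () here
  ∣S∣≡0⇒∉ {S = inside  ∷ S} () (there _)
  ∣S∣≡0⇒∉ {S = outside ∷ S} e  (there x∈S) = ∣S∣≡0⇒∉ e x∈S

  ∣S∣≡1+⇒Nonempty : ∣ S ∣ ≡ suc k → Nonempty S
  ∣S∣≡1+⇒Nonempty {S = inside  ∷ S} _ = zero , here
  ∣S∣≡1+⇒Nonempty {S = outside ∷ S} e = let x , x∈S = ∣S∣≡1+⇒Nonempty e in suc x , there x∈S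

  record IsTriple (S : Subset n) (a b c : Fin n) : Set where
    field
      a∈S : a ∈ S
      b∈S : b ∈ S
      c∈S : c ∈ S
      a≢b : a ≢ b
      a≢c : a ≢ c
      b≢c : b ≢ c
      exhaustive : x ∈ S → x ≡ a ⊎ x ≡ b ⊎ x ≡ c

  swap-IsTriple : IsTriple S a b c → IsTriple S b a c
  swap-IsTriple T = record
    { a∈S = b∈S ; b∈S = a∈S ; c∈S = c∈S ; a≢b = a≢b ∘ sym ; a≢c = b≢c ; b≢c = a≢c
    ; exhaustive = λ x∈S → swap (exhaustive x∈S) }
    where
    open IsTriple T
    swap : ∀ {A B C : Set} → A ⊎ B ⊎ C → B ⊎ A ⊎ C
    swap (inj₁ p)        = inj₂ (inj₁ p)
    swap (inj₂ (inj₁ p)) = inj₁ p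
    swap (inj₂ (inj₂ p)) = inj₂ (inj₂ p)

  rotate-IsTriple : IsTriple S a b c → IsTriple S b c a
  rotate-IsTriple T = record
    { a∈S = b∈S ; b∈S = c∈S ; c∈S = a∈S ; a≢b = b≢c ; a≢c = a≢b ∘ sym ; b≢c = a≢c ∘ sym
    ; exhaustive = λ x∈S → rotate (exhaustive x∈S) }
    where
    open IsTriple T
    rotate : ∀ {A B C : Set} → A ⊎ B ⊎ C → B ⊎ C ⊎ A
    rotate (inj₁ p)        = inj₂ (inj₂ p)
    rotate (inj₂ (inj₁ p)) = inj₁ p
    rotate (inj₂ (inj₂ p)) = inj₂ (inj₁ p)

  ∣S∣≡3⇒IsTriple : ∣ S ∣ ≡ 3 → ∃[ a ] ∃[ b ] ∃[ c ] IsTriple S a b c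
  ∣S∣≡3⇒IsTriple {S = S} ∣S∣≡3
    with a , a∈S  ← ∣S∣≡1+⇒Nonempty ∣S∣≡3
    with b , b∈S₁ ← ∣S∣≡1+⇒Nonempty (∣S∣≡1+k⇒∣remove∣≡k a∈S ∣S∣≡3)
    with c , c∈S₂ ← ∣S∣≡1+⇒Nonempty (∣S∣≡1+k⇒∣remove∣≡k b∈S₁ (∣S∣≡1+k⇒∣remove∣≡k a∈S ∣S∣≡3))
    = a , b , c , record
        { a∈S = a∈S ; b∈S = b∈S ; c∈S = c∈S
        ; a≢b = b≢a ∘ sym ; a≢c = c≢a ∘ sym ; b≢c = c≢b ∘ sym
        ; exhaustive = exhaustive }
    where
    b∈S = proj₁ (∈-remove⁻ b∈S₁)
    b≢a = proj₂ (∈-remove⁻ b∈S₁)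
    c∈S = proj₁ (∈-remove⁻ (proj₁ (∈-remove⁻ c∈S₂)))
    c≢a = proj₂ (∈-remove⁻ (proj₁ (∈-remove⁻ c∈S₂)))
    c≢b = proj₂ (∈-remove⁻ c∈S₂)
    exhaustive : x ∈ S → x ≡ a ⊎ x ≡ b ⊎ x ≡ c
    exhaustive {x} x∈S with x Fin.≟ a | x Fin.≟ b | x Fin.≟ c
    ... | yes x≡a | _       | _       = inj₁ x≡a
    ... | no _    | yes x≡b | _       = inj₂ (inj₁ x≡b)
    ... | no _    | no _    | yes x≡c = inj₂ (inj₂ x≡c)
    ... | no x≢a  | no x≢b  | no x≢c  =
      ⊥-elim (∣S∣≡0⇒∉ (∣S∣≡1+k⇒∣remove∣≡k c∈S₂ (∣S∣≡1+k⇒∣remove∣≡k b∈S₁ (∣S∣≡1+k⇒∣remove∣≡k a∈S ∣S∣≡3)))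
                      (∈-remove⁺ (∈-remove⁺ (∈-remove⁺ x∈S x≢a) x≢b) x≢c))

  ∈∉⇒≢ : x ∈ S → y ∉ S → x ≢ y
  ∈∉⇒≢ x∈ y∉ refl = y∉ x∈

  IsTriple-third : IsTriple S a b c → x ∈ S → y ∈ S → x ≢ y → ∃[ z ] IsTriple S x y z
  IsTriple-third T x∈S y∈S x≢y with IsTriple.exhaustive T x∈S | IsTriple.exhaustive T y∈S
  ... | inj₁ refl        | inj₁ refl        = ⊥-elim (x≢y refl)
  ... | inj₁ refl        | inj₂ (inj₁ refl) = _ , T
  ... | inj₁ refl        | inj₂ (inj₂ refl) = _ , swap-IsTriple (rotate-IsTriple (rotate-IsTriple T))
  ... | inj₂ (inj₁ refl) | inj₁ refl        = _ , swap-IsTriple T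
  ... | inj₂ (inj₁ refl) | inj₂ (inj₁ refl) = ⊥-elim (x≢y refl)
  ... | inj₂ (inj₁ refl) | inj₂ (inj₂ refl) = _ , rotate-IsTriple T
  ... | inj₂ (inj₂ refl) | inj₁ refl        = _ , rotate-IsTriple (rotate-IsTriple T)
  ... | inj₂ (inj₂ refl) | inj₂ (inj₁ refl) = _ , swap-IsTriple (rotate-IsTriple T)
  ... | inj₂ (inj₂ refl) | inj₂ (inj₂ refl) = ⊥-elim (x≢y refl)

  3≤∣S∣ : a ∈ S → b ∈ S → c ∈ S → a ≢ b → a ≢ c → b ≢ c → 3 ≤ ∣ S ∣
  3≤∣S∣ {S = S} a∈S b∈S c∈S a≢b a≢c b≢c
    rewrite ∣S∣≡1+∣remove∣ a∈S
          | ∣S∣≡1+∣remove∣ (∈-remove⁺ b∈S (a≢b ∘ sym))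
          | ∣S∣≡1+∣remove∣ (∈-remove⁺ (∈-remove⁺ c∈S (a≢c ∘ sym)) (b≢c ∘ sym))
    = s≤s (s≤s (s≤s z≤n))

  subset : {P : Pred (Fin n) ℓ₁} → Decidable P → Subset n
  subset P? = tabulate (does ∘ P?)

  ∈-subset⁺ : {P : Pred (Fin n) ℓ₁} (P? : Decidable P) {x : Fin n} → P x → x ∈ subset P?
  ∈-subset⁺ P? {x} Px = lookup⇒[]= x _ (trans (lookup∘tabulate _ x) (dec-true (P? x) Px))

  ∈-subset⁻ : {P : Pred (Fin n) ℓ₁} (P? : Decidable P) {x : Fin n} → x ∈ subset P? → P x
  ∈-subset⁻ P? {x} x∈ with P? x in eq
  ... | yes Px = Px
  ... | no  _ with () ← trans (sym (trans (lookup∘tabulate (does ∘ P?) x) (cong does eq))) ([]=⇒lookup x∈)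

open Subsets

∃-distinct-from : 3 ≤ n → (u v : Fin n) → ∃[ x ] (x ≢ u × x ≢ v)
∃-distinct-from (s≤s (s≤s (s≤s _))) zero          zero          = suc zero , (λ ()) , (λ ())
∃-distinct-from (s≤s (s≤s (s≤s _))) zero          (suc zero)    = suc (suc zero) , (λ ()) , (λ ())
∃-distinct-from (s≤s (s≤s (s≤s _))) zero          (suc (suc _)) = suc zero , (λ ()) , (λ ())
∃-distinct-from (s≤s (s≤s (s≤s _))) (suc zero)    zero          = suc (suc zero) , (λ ()) , (λ ())
∃-distinct-from (s≤s (s≤s (s≤s _))) (suc (suc _)) zero          = suc zero , (λ ()) , (λ ())
∃-distinct-from (s≤s (s≤s (s≤s _))) (suc _)       (suc _)       = zero , (λ ()) , (λ ())

least : {P : Pred ℕ ℓ₁} → Decidable P → ∀ {N} → P N → ∃[ i ] (P i × ∀ {j} → j < i → ¬ P j)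
least P? {zero} P0 = 0 , P0 , λ ()
least P? {suc N} PN with P? 0
... | yes P0 = 0 , P0 , λ ()
... | no ¬P0 with i , Pi , below ← least (P? ∘ suc) PN =
  suc i , Pi , λ { {zero} _ → ¬P0 ; {suc j} j<i → below (s≤s⁻¹ j<i) }

¬¬-∀-Fin : {P : Pred (Fin n) ℓ₁} → (∀ i → ¬ ¬ P i) → ¬ ¬ (∀ i → P i)
¬¬-∀-Fin {zero}  _   k = k λ ()
¬¬-∀-Fin {suc n} ¬¬P k = ¬¬P zero λ P0 → ¬¬-∀-Fin (¬¬P ∘ suc) λ Ps → k λ { zero → P0 ; (suc i) → Ps i }

argmax-Fin : {P : Pred (Fin n) ℓ₁} → Decidable P → (g : Fin n → ℕ) →
             ∃[ y ] P y → ∃[ m ] (P m × ∀ {y} → P y → g y ≤ g m)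
argmax-Fin {n} P? g (y₀ , Py₀) =
  m , argmax-all g Py₀ (all-filter P? (allFin n)) ,
  λ {y} Py → All.lookup (f[xs]≤f[argmax] y₀ ys) (∈-filter⁺ P? (∈-allFin y) Py)
  where
  ys = filter P? (allFin n)
  m  = argmax g y₀ ys

module CyclicOrder where

  private
    variable
      a b r x y z : ℕ

  -- unlike ArcN, which allows b ≡ a, this forces a, x, b to be distinct
  Cyclic : ℕ → ℕ → ℕ → Set
  Cyclic a x b = (a < x × x < b) ⊎ (x < b × b < a) ⊎ (b < a × a < x)

  Arc⇒Cyclic : a ≢ b → ArcN a x b → Cyclic a x b
  Arc⇒Cyclic a≢b (inj₁ a<x<b)            = inj₁ a<x<b
  Arc⇒Cyclic a≢b (inj₂ (b≤a , inj₁ a<x)) = inj₂ (inj₂ (≤∧≢⇒< b≤a (a≢b ∘ sym) , a<x))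
  Arc⇒Cyclic a≢b (inj₂ (b≤a , inj₂ x<b)) = inj₂ (inj₁ (x<b , ≤∧≢⇒< b≤a (λ e → a≢b (sym e))))

  Cyclic⇒Arc : Cyclic a x b → ArcN a x b
  Cyclic⇒Arc (inj₁ a<x<b)                = inj₁ a<x<b
  Cyclic⇒Arc (inj₂ (inj₁ (x<b , b<a)))   = inj₂ (<⇒≤ b<a , inj₂ x<b)
  Cyclic⇒Arc (inj₂ (inj₂ (b<a , a<x)))   = inj₂ (<⇒≤ b<a , inj₁ a<x)

  Cyclic-rotate : Cyclic a x b → Cyclic x b a
  Cyclic-rotate (inj₁ p)        = inj₂ (inj₂ p)
  Cyclic-rotate (inj₂ (inj₁ p)) = inj₁ p
  Cyclic-rotate (inj₂ (inj₂ p)) = inj₂ (inj₁ p)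

  Cyclic-asym : Cyclic a x b → ¬ Cyclic b x a
  Cyclic-asym (inj₁ (p , q))        (inj₁ (r , s))        = <-asym (<-trans p q) (<-trans r s)
  Cyclic-asym (inj₁ (p , q))        (inj₂ (inj₁ (r , s))) = <-asym p r
  Cyclic-asym (inj₁ (p , q))        (inj₂ (inj₂ (r , s))) = <-asym q s
  Cyclic-asym (inj₂ (inj₁ (p , q))) (inj₁ (r , s))        = <-asym p r
  Cyclic-asym (inj₂ (inj₁ (p , q))) (inj₂ (inj₁ (r , s))) = <-asym q s
  Cyclic-asym (inj₂ (inj₁ (p , q))) (inj₂ (inj₂ (r , s))) = <-asym p s
  Cyclic-asym (inj₂ (inj₂ (p , q))) (inj₁ (r , s))        = <-asym q s
  Cyclic-asym (inj₂ (inj₂ (p , q))) (inj₂ (inj₁ (r , s))) = <-asym p s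
  Cyclic-asym (inj₂ (inj₂ (p , q))) (inj₂ (inj₂ (r , s))) = <-asym p r

  Cyclic-total : a ≢ x → x ≢ b → a ≢ b → Cyclic a x b ⊎ Cyclic b x a
  Cyclic-total {a} {x} {b} a≢x x≢b a≢b with <-cmp a x | <-cmp x b | <-cmp a b
  ... | tri≈ _ e _ | _          | _          = ⊥-elim (a≢x e)
  ... | _          | tri≈ _ e _ | _          = ⊥-elim (x≢b e)
  ... | _          | _          | tri≈ _ e _ = ⊥-elim (a≢b e)
  ... | tri< p _ _ | tri< q _ _ | _          = inj₁ (inj₁ (p , q))
  ... | tri< p _ _ | tri> _ _ q | tri< r _ _ = inj₂ (inj₂ (inj₂ (r , q)))
  ... | tri< p _ _ | tri> _ _ q | tri> _ _ r = inj₁ (inj₂ (inj₂ (r , p)))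
  ... | tri> _ _ p | tri< q _ _ | tri< r _ _ = inj₂ (inj₂ (inj₁ (p , r)))
  ... | tri> _ _ p | tri< q _ _ | tri> _ _ r = inj₁ (inj₂ (inj₁ (q , r)))
  ... | tri> _ _ p | tri> _ _ q | _          = inj₂ (inj₁ (q , p))

  Cyclic⇒distinct : Cyclic a x b → a ≢ x × x ≢ b × a ≢ b
  Cyclic⇒distinct {a} {x} {b} c =
    (λ { refl → irrefl₁ c }) , (λ { refl → irrefl₂ c }) , (λ { refl → irrefl₃ c })
    where
    irrefl₁ : ¬ Cyclic a a b
    irrefl₁ (inj₁ (p , _))        = <-irrefl refl p
    irrefl₁ (inj₂ (inj₁ (p , q))) = <-asym p q
    irrefl₁ (inj₂ (inj₂ (_ , q))) = <-irrefl refl q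
    irrefl₂ : ¬ Cyclic a b b
    irrefl₂ (inj₁ (_ , q))        = <-irrefl refl q
    irrefl₂ (inj₂ (inj₁ (p , _))) = <-irrefl refl p
    irrefl₂ (inj₂ (inj₂ (p , q))) = <-asym p q
    irrefl₃ : ¬ Cyclic a x a
    irrefl₃ (inj₁ (p , q))        = <-asym p q
    irrefl₃ (inj₂ (inj₁ (_ , q))) = <-irrefl refl q
    irrefl₃ (inj₂ (inj₂ (p , _))) = <-irrefl refl p

  Cyclic-linear⁻ : a < b → Cyclic a x b → a < x × x < b
  Cyclic-linear⁻ a<b (inj₁ a<x<b)            = a<x<b
  Cyclic-linear⁻ a<b (inj₂ (inj₁ (_ , b<a))) = ⊥-elim (<-asym a<b b<a)
  Cyclic-linear⁻ a<b (inj₂ (inj₂ (b<a , _))) = ⊥-elim (<-asym a<b b<a)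

  0-first⁻ : Cyclic 0 x b → 0 < x × x < b
  0-first⁻ (inj₁ p)              = p
  0-first⁻ (inj₂ (inj₁ (_ , ())))
  0-first⁻ (inj₂ (inj₂ (() , _)))

  0-last⁻ : Cyclic a x 0 → 0 < a × a < x
  0-last⁻ (inj₁ (_ , ()))
  0-last⁻ (inj₂ (inj₁ (() , _)))
  0-last⁻ (inj₂ (inj₂ p)) = p

  0-last⁺ : 0 < a → a < x → Cyclic a x 0
  0-last⁺ 0<a a<x = inj₂ (inj₂ (0<a , a<x))

  0-middle⁺ : 0 < b → b < a → Cyclic a 0 b
  0-middle⁺ 0<b b<a = inj₂ (inj₁ (0<b , b<a))

  -- offset r y is the clockwise distance from r to y on a circle of n positions; it turns cyclic
  -- order into linear order starting at r
  module Offset (n : ℕ) where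

    offset : ℕ → ℕ → ℕ
    offset r y with r ≤? y
    ... | yes _ = y ∸ r
    ... | no  _ = y + n ∸ r

    private
      offset-≥ : r ≤ y → offset r y ≡ y ∸ r
      offset-≥ {r} {y} r≤y with r ≤? y
      ... | yes _  = refl
      ... | no r≰y = ⊥-elim (r≰y r≤y)

      offset-< : y < r → offset r y ≡ y + n ∸ r
      offset-< {y} {r} y<r with r ≤? y
      ... | yes r≤y = ⊥-elim (<⇒≱ y<r r≤y)
      ... | no  _   = refl

      ≤-or-> : ∀ r y → r ≤ y ⊎ y < r
      ≤-or-> r y with r ≤? y
      ... | yes r≤y = inj₁ r≤y
      ... | no  r≰y = inj₂ (≰⇒> r≰y)

      mono-≥ : r ≤ y → y < z → offset r y < offset r z
      mono-≥ r≤y y<z rewrite offset-≥ r≤y | offset-≥ (≤-trans r≤y (<⇒≤ y<z)) = ∸-monoˡ-< y<z r≤y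

      mono-< : r ≤ n → y < z → z < r → offset r y < offset r z
      mono-< {r} {y} {z} r≤n y<z z<r rewrite offset-< (<-trans y<z z<r) | offset-< z<r =
        ∸-monoˡ-< (+-monoˡ-< n y<z) (≤-trans r≤n (m≤n+m n y))

      wrap : z < n → y < r → r ≤ z → offset r z < offset r y
      wrap {z} {y} {r} z<n y<r r≤z rewrite offset-< y<r | offset-≥ r≤z =
        ∸-monoˡ-< (<-≤-trans z<n (m≤n+m n y)) r≤z

      offset-≢ : r ≤ n → z < n → y < z → offset r y ≢ offset r z
      offset-≢ {r} {z} {y} r≤n z<n y<z e with ≤-or-> r y | ≤-or-> r z
      ... | inj₁ r≤y | _        = <-irrefl e (mono-≥ r≤y y<z)
      ... | inj₂ y<r | inj₁ r≤z = <-irrefl (sym e) (wrap z<n y<r r≤z)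
      ... | inj₂ y<r | inj₂ z<r = <-irrefl e (mono-< r≤n y<z z<r)

      Cyclic-offset-linear : r ≤ n → b < n → a < x → x < b →
                             Cyclic (offset r a) (offset r x) (offset r b)
      Cyclic-offset-linear {r} {b} {a} {x} r≤n b<n a<x x<b with ≤-or-> r a | ≤-or-> r x | ≤-or-> r b
      ... | inj₁ r≤a | _        | _        = inj₁ (mono-≥ r≤a a<x , mono-≥ (≤-trans r≤a (<⇒≤ a<x)) x<b)
      ... | inj₂ a<r | inj₁ r≤x | _        = inj₂ (inj₁ (mono-≥ r≤x x<b , wrap b<n a<r (≤-trans r≤x (<⇒≤ x<b))))
      ... | inj₂ a<r | inj₂ x<r | inj₁ r≤b = inj₂ (inj₂ (wrap b<n a<r r≤b , mono-< r≤n a<x x<r))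
      ... | inj₂ a<r | inj₂ x<r | inj₂ b<r = inj₁ (mono-< r≤n a<x x<r , mono-< r≤n x<b b<r)

    offset-self : ∀ r → offset r r ≡ 0
    offset-self r = trans (offset-≥ {r} ≤-refl) (n∸n≡0 r)

    offset-injective : r ≤ n → y < n → z < n → offset r y ≡ offset r z → y ≡ z
    offset-injective {r} {y} {z} r≤n y<n z<n e with <-cmp y z
    ... | tri< y<z _ _ = ⊥-elim (offset-≢ r≤n z<n y<z e)
    ... | tri≈ _ y≡z _ = y≡z
    ... | tri> _ _ z<y = ⊥-elim (offset-≢ r≤n y<n z<y (sym e))

    Cyclic-offset : r ≤ n → a < n → x < n → b < n →
                    Cyclic a x b → Cyclic (offset r a) (offset r x) (offset r b)
    Cyclic-offset r≤n a<n x<n b<n (inj₁ (a<x , x<b)) =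
      Cyclic-offset-linear r≤n b<n a<x x<b
    Cyclic-offset r≤n a<n x<n b<n (inj₂ (inj₁ (x<b , b<a))) =
      Cyclic-rotate (Cyclic-rotate (Cyclic-offset-linear r≤n a<n x<b b<a))
    Cyclic-offset r≤n a<n x<n b<n (inj₂ (inj₂ (b<a , a<x))) =
      Cyclic-rotate (Cyclic-offset-linear r≤n x<n b<a a<x)

    Cyclic-offset⁻ : r ≤ n → a < n → x < n → b < n →
                     Cyclic (offset r a) (offset r x) (offset r b) → Cyclic a x b
    Cyclic-offset⁻ r≤n a<n x<n b<n c
      with a≢x , x≢b , a≢b ← Cyclic⇒distinct c
      with Cyclic-total (a≢x ∘ cong _) (x≢b ∘ cong _) (a≢b ∘ cong _)
    ... | inj₁ c′ = c′
    ... | inj₂ c′ = ⊥-elim (Cyclic-asym c (Cyclic-offset r≤n b<n x<n a<n c′))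

open CyclicOrder

module Outerplanar {n : ℕ} {E : Fin n → Fin n → Set} {pos : Fin n → Fin n}
                   (acyclic : Acyclic E) (drawing : OuterplanarDrawing pos E) where

  private
    variable
      a b c d r u v w x y : Fin n

  ¬loop : ¬ E u u
  ¬loop e = acyclic _ [ e ]

  ¬2-cycle : E u v → ¬ E v u
  ¬2-cycle e e′ = acyclic _ (e ∷ [ e′ ])

  ¬3-cycle : E u v → E v w → ¬ E w u
  ¬3-cycle e e′ e″ = acyclic _ (e ∷ e′ ∷ [ e″ ])

  Adj-sym : Adj E u v → Adj E v u
  Adj-sym (inj₁ e) = inj₂ e
  Adj-sym (inj₂ e) = inj₁ e

  Adj⇒≢ : Adj E u v → u ≢ v
  Adj⇒≢ (inj₁ e) refl = ¬loop e
  Adj⇒≢ (inj₂ e) refl = ¬loop e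

  Adj-reverse : Adj E u v → ¬ E u v → E v u
  Adj-reverse (inj₁ e) ¬e = ⊥-elim (¬e e)
  Adj-reverse (inj₂ e) _  = e

  Adj⇒Dec : Adj E u v → Dec (E u v)
  Adj⇒Dec (inj₁ e) = yes e
  Adj⇒Dec (inj₂ e) = no (¬2-cycle e)

  P : Fin n → ℕ
  P v = toℕ (pos v)

  P<n : ∀ v → P v < n
  P<n v = Fin.toℕ<n (pos v)

  P-injective : P u ≡ P v → u ≡ v
  P-injective e = proj₁ drawing (Fin.toℕ-injective e)

  Cy : Fin n → Fin n → Fin n → Set
  Cy a x b = Cyclic (P a) (P x) (P b)

  Arc⇒Cy : a ≢ b → Arc pos a x b → Cy a x b
  Arc⇒Cy a≢b = Arc⇒Cyclic (a≢b ∘ P-injective)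

  Cy-total : a ≢ x → x ≢ b → a ≢ b → Cy a x b ⊎ Cy b x a
  Cy-total a≢x x≢b a≢b = Cyclic-total (a≢x ∘ P-injective) (x≢b ∘ P-injective) (a≢b ∘ P-injective)

  ¬crossing : Adj E a b → Adj E c d → Cy a c b → Cy b d a → ⊥
  ¬crossing ab cd c₁ c₂ = proj₂ drawing _ _ _ _ ab cd (Cyclic⇒Arc c₁ , Cyclic⇒Arc c₂)

  open Offset n

  δ : Fin n → Fin n → ℕ
  δ r x = offset (P r) (P x)

  δ-self : ∀ r → δ r r ≡ 0
  δ-self r = offset-self (P r)

  δ-injective : ∀ r → δ r x ≡ δ r y → x ≡ y
  δ-injective r e = P-injective (offset-injective (<⇒≤ (P<n r)) (P<n _) (P<n _) e)

  δ-pos : ∀ r → x ≢ r → 0 < δ r x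
  δ-pos {x} r x≢r with δ r x in eq
  ... | zero  = ⊥-elim (x≢r (δ-injective r (trans eq (sym (δ-self r)))))
  ... | suc _ = s≤s z≤n

  Cy⇒δ : ∀ r → Cy a x b → Cyclic (δ r a) (δ r x) (δ r b)
  Cy⇒δ r = Cyclic-offset (<⇒≤ (P<n r)) (P<n _) (P<n _) (P<n _)

  δ⇒Cy : ∀ r → Cyclic (δ r a) (δ r x) (δ r b) → Cy a x b
  δ⇒Cy r = Cyclic-offset⁻ (<⇒≤ (P<n r)) (P<n _) (P<n _) (P<n _)

  Cy-start⁻ : Cy r x b → 0 < δ r x × δ r x < δ r b
  Cy-start⁻ {r} {x} {b} c = 0-first⁻ (subst (λ o → Cyclic o (δ r x) (δ r b)) (δ-self r) (Cy⇒δ r c))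

  Cy-start⁺ : 0 < δ r x → δ r x < δ r b → Cy r x b
  Cy-start⁺ {r} {x} {b} 0<x x<b =
    δ⇒Cy r (subst (λ o → Cyclic o (δ r x) (δ r b)) (sym (δ-self r)) (inj₁ (0<x , x<b)))

  Cy-end⁻ : Cy a x r → 0 < δ r a × δ r a < δ r x
  Cy-end⁻ {a} {x} {r} c = 0-last⁻ (subst (Cyclic (δ r a) (δ r x)) (δ-self r) (Cy⇒δ r c))

  Cy-end⁺ : 0 < δ r a → δ r a < δ r x → Cy a x r
  Cy-end⁺ {r} {a} {x} 0<a a<x =
    δ⇒Cy r (subst (Cyclic (δ r a) (δ r x)) (sym (δ-self r)) (0-last⁺ 0<a a<x))

  Cy-middle⁺ : 0 < δ r b → δ r b < δ r a → Cy a r b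
  Cy-middle⁺ {r} {b} {a} 0<b b<a =
    δ⇒Cy r (subst (λ o → Cyclic (δ r a) o (δ r b)) (sym (δ-self r)) (0-middle⁺ 0<b b<a))

  Cy-linear⁻ : ∀ r → δ r a < δ r b → Cy a x b → δ r a < δ r x × δ r x < δ r b
  Cy-linear⁻ r a<b c = Cyclic-linear⁻ a<b (Cy⇒δ r c)

  Cy-linear⁺ : ∀ r → δ r a < δ r x → δ r x < δ r b → Cy a x b
  Cy-linear⁺ r a<x x<b = δ⇒Cy r (inj₁ (a<x , x<b))

  SameSide : Fin n → Fin n → Fin n → Fin n → Set
  SameSide a b x y = (Cy a x b × Cy a y b) ⊎ (Cy b x a × Cy b y a)

  Opposite : Fin n → Fin n → Fin n → Fin n → Set
  Opposite a b x y = (Cy a x b × Cy b y a) ⊎ (Cy b x a × Cy a y b)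

  ClosedSide : Fin n → Fin n → Fin n → Fin n → Set
  ClosedSide a b w x = x ≡ a ⊎ x ≡ b ⊎ SameSide a b x w

  SameSide-swap : SameSide a b x y → SameSide b a x y
  SameSide-swap (inj₁ p) = inj₂ p
  SameSide-swap (inj₂ p) = inj₁ p

  Opposite-swap : Opposite a b x y → Opposite b a x y
  Opposite-swap (inj₁ p) = inj₂ p
  Opposite-swap (inj₂ p) = inj₁ p

  Opposite-sym : Opposite a b x y → Opposite a b y x
  Opposite-sym (inj₁ (p , q)) = inj₂ (q , p)
  Opposite-sym (inj₂ (p , q)) = inj₁ (q , p)

  SameSide-refl : a ≢ x → x ≢ b → a ≢ b → SameSide a b x x
  SameSide-refl a≢x x≢b a≢b with Cy-total a≢x x≢b a≢b
  ... | inj₁ c = inj₁ (c , c)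
  ... | inj₂ c = inj₂ (c , c)

  SameSide-Opposite : SameSide a b x w → SameSide a b x r → ¬ Opposite a b w r
  SameSide-Opposite (inj₁ (_ , p)) (inj₁ (_ , q)) (inj₁ (_ , r)) = Cyclic-asym q r
  SameSide-Opposite (inj₁ (_ , p)) (inj₁ _)       (inj₂ (r , _)) = Cyclic-asym p r
  SameSide-Opposite (inj₁ (p , _)) (inj₂ (q , _)) _              = Cyclic-asym p q
  SameSide-Opposite (inj₂ (p , _)) (inj₁ (q , _)) _              = Cyclic-asym p q
  SameSide-Opposite (inj₂ (_ , p)) (inj₂ _)       (inj₁ (r , _)) = Cyclic-asym p r
  SameSide-Opposite (inj₂ (_ , p)) (inj₂ (_ , q)) (inj₂ (_ , r)) = Cyclic-asym q r

  ClosedSide-swap : ClosedSide a b w x → ClosedSide b a w x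
  ClosedSide-swap (inj₁ e)        = inj₂ (inj₁ e)
  ClosedSide-swap (inj₂ (inj₁ e)) = inj₁ e
  ClosedSide-swap (inj₂ (inj₂ s)) = inj₂ (inj₂ (SameSide-swap s))

  ClosedSide-nest : Opposite a b w r → ClosedSide a b w x → ClosedSide a r b x
  ClosedSide-nest {a} {b} {w} {r} {x} (inj₁ (c₁ , c₂)) = nest
    where
    w<b = proj₂ (Cy-start⁻ {a} c₁)
    0<b = proj₁ (Cy-end⁻ {r = a} c₂)
    b<r = proj₂ (Cy-end⁻ {r = a} c₂)
    nest : ClosedSide a b w x → ClosedSide a r b x
    nest (inj₁ e)                  = inj₁ e
    nest (inj₂ (inj₁ refl))        = inj₂ (inj₂ (inj₁ (Cy-start⁺ 0<b b<r , Cy-start⁺ 0<b b<r)))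
    nest (inj₂ (inj₂ (inj₁ (d , _)))) =
      let 0<x , x<b = Cy-start⁻ {a} d in inj₂ (inj₂ (inj₁ (Cy-start⁺ 0<x (<-trans x<b b<r) , Cy-start⁺ 0<b b<r)))
    nest (inj₂ (inj₂ (inj₂ (_ , d)))) = ⊥-elim (<-asym w<b (proj₂ (Cy-end⁻ {r = a} d)))
  ClosedSide-nest {a} {b} {w} {r} {x} (inj₂ (c₁ , c₂)) = nest
    where
    b<w = proj₂ (Cy-end⁻ {r = a} c₁)
    0<r = proj₁ (Cy-start⁻ {a} c₂)
    r<b = proj₂ (Cy-start⁻ {a} c₂)
    nest : ClosedSide a b w x → ClosedSide a r b x
    nest (inj₁ e)                  = inj₁ e
    nest (inj₂ (inj₁ refl))        = inj₂ (inj₂ (inj₂ (Cy-end⁺ 0<r r<b , Cy-end⁺ 0<r r<b)))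
    nest (inj₂ (inj₂ (inj₁ (_ , d)))) = ⊥-elim (<-asym b<w (proj₂ (Cy-start⁻ {a} d)))
    nest (inj₂ (inj₂ (inj₂ (d , _)))) =
      let _ , b<x = Cy-end⁻ {r = a} d in inj₂ (inj₂ (inj₂ (Cy-end⁺ 0<r (<-trans r<b b<x) , Cy-end⁺ 0<r r<b)))

  ClosedSide-nest′ : Opposite u v w r → a ≡ u × b ≡ v ⊎ a ≡ v × b ≡ u →
                     ClosedSide u v w x → ClosedSide a r b x
  ClosedSide-nest′ opp (inj₁ (refl , refl)) = ClosedSide-nest opp
  ClosedSide-nest′ opp (inj₂ (refl , refl)) = ClosedSide-nest (Opposite-swap opp) ∘ ClosedSide-swap

  orient-triangle : ∀ {S : Subset n} → IsTriple S a b c → Adj E a b → Adj E a c → Adj E b c →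
                    ∃[ x ] ∃[ m ] ∃[ y ] (IsTriple S x m y × E x m × E m y × E x y)
  orient-triangle T (inj₁ a→b) (inj₁ a→c) (inj₁ b→c) = _ , _ , _ , T , a→b , b→c , a→c
  orient-triangle T (inj₁ a→b) (inj₁ a→c) (inj₂ c→b) =
    _ , _ , _ , swap-IsTriple (rotate-IsTriple (rotate-IsTriple T)) , a→c , c→b , a→b
  orient-triangle T (inj₁ a→b) (inj₂ c→a) (inj₁ b→c) = ⊥-elim (¬3-cycle a→b b→c c→a)
  orient-triangle T (inj₁ a→b) (inj₂ c→a) (inj₂ c→b) =
    _ , _ , _ , rotate-IsTriple (rotate-IsTriple T) , c→a , a→b , c→b
  orient-triangle T (inj₂ b→a) (inj₁ a→c) (inj₁ b→c) = _ , _ , _ , swap-IsTriple T , b→a , a→c , b→c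
  orient-triangle T (inj₂ b→a) (inj₁ a→c) (inj₂ c→b) = ⊥-elim (¬3-cycle b→a a→c c→b)
  orient-triangle T (inj₂ b→a) (inj₂ c→a) (inj₁ b→c) = _ , _ , _ , rotate-IsTriple T , b→c , c→a , b→a
  orient-triangle T (inj₂ b→a) (inj₂ c→a) (inj₂ c→b) =
    _ , _ , _ , swap-IsTriple (rotate-IsTriple T) , c→b , b→a , c→a

module Faces {n : ℕ} {E : Fin n → Fin n → Set} {pos : Fin n → Fin n}
             (acyclic : Acyclic E) (drawing : OuterplanarDrawing pos E)
             (triangulated : InternallyTriangulated pos E)
             {h : ℕ} {f : Fin h → Subset n} (ordering : FaceOrdering pos E h f) where

  open Outerplanar acyclic drawing

  private
    variable
      i j k l : ℕ
      a b c r u v w x y z : Fin n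

  F : ℕ → Subset n
  F k with k <? h
  ... | yes k<h = f (fromℕ< k<h)
  ... | no  _   = ∅

  ∈F⇒<h : x ∈ F k → k < h
  ∈F⇒<h {k = k} x∈ with k <? h
  ... | yes k<h = k<h
  ... | no  _   = ⊥-elim (∉⊥ x∈)

  F≡f : (k<h : k < h) → F k ≡ f (fromℕ< k<h)
  F≡f {k} k<h with k <? h
  ... | yes _   = refl
  ... | no  k≮h = ⊥-elim (k≮h k<h)

  F-toℕ : (i : Fin h) → F (toℕ i) ≡ f i
  F-toℕ i = trans (F≡f (Fin.toℕ<n i)) (cong f (Fin.fromℕ<-toℕ i _))

  private
    isFace = proj₁ ordering
    allFaces = proj₁ (proj₂ ordering)
    injective = proj₁ (proj₂ (proj₂ ordering))
    sharing⇒consecutive = proj₁ (proj₂ (proj₂ (proj₂ ordering)))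
    consecutive⇒sharing = proj₂ (proj₂ (proj₂ (proj₂ ordering)))

  F-face : k < h → IsInnerFace pos E (F k)
  F-face k<h = subst (IsInnerFace pos E) (sym (F≡f k<h)) (isFace _)

  F-triple : k < h → ∃[ a ] ∃[ b ] ∃[ c ] IsTriple (F k) a b c
  F-triple k<h = ∣S∣≡3⇒IsTriple (triangulated _ (F-face k<h))

  face⇒F : ∀ {S} → IsInnerFace pos E S → x ∈ S → y ∈ S → ∃[ k ] (x ∈ F k × y ∈ F k)
  face⇒F {x} {y} S-face x∈S y∈S = let i , fi≡S = allFaces _ S-face ; Fi≡S = trans (F-toℕ i) fi≡S in
    toℕ i , subst (x ∈_) (sym Fi≡S) x∈S , subst (y ∈_) (sym Fi≡S) y∈S

  F-injective : k < h → l < h → F k ≡ F l → k ≡ l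
  F-injective k<h l<h Fk≡Fl = trans (sym (Fin.toℕ-fromℕ< k<h))
    (trans (cong toℕ (injective (trans (sym (F≡f k<h)) (trans Fk≡Fl (F≡f l<h))))) (Fin.toℕ-fromℕ< l<h))

  F-share : suc k < h → ShareEdge pos E (F k) (F (suc k))
  F-share {k} 1+k<h rewrite F≡f (<-trans (n<1+n k) 1+k<h) | F≡f 1+k<h =
    consecutive⇒sharing _ _ (inj₂ (trans (Fin.toℕ-fromℕ< 1+k<h) (cong suc (sym (Fin.toℕ-fromℕ< _)))))

  private
    ∈F⇒∈f : (k<h : k < h) → x ∈ F k → x ∈ f (fromℕ< k<h)
    ∈F⇒∈f {x = x} k<h = subst (x ∈_) (F≡f k<h)

  shared-edge⇒consecutive : k < l → E u v → u ∈ F k → v ∈ F k → u ∈ F l → v ∈ F l → l ≡ suc k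
  shared-edge⇒consecutive {k} {l} {u} {v} k<l e u∈k v∈k u∈l v∈l
    with k<h ← ∈F⇒<h u∈k | l<h ← ∈F⇒<h u∈l
    with sharing⇒consecutive (fromℕ< k<h) (fromℕ< l<h)
           (λ eq → <-irrefl (trans (sym (Fin.toℕ-fromℕ< k<h)) (trans (cong toℕ eq) (Fin.toℕ-fromℕ< l<h))) k<l)
           (u , v , e , ∈F⇒∈f k<h u∈k , ∈F⇒∈f k<h v∈k , ∈F⇒∈f l<h u∈l , ∈F⇒∈f l<h v∈l)
  ... | inj₁ k≡1+l rewrite Fin.toℕ-fromℕ< k<h | Fin.toℕ-fromℕ< l<h =
    ⊥-elim (<-asym k<l (subst (l <_) (sym k≡1+l) (n<1+n l)))
  ... | inj₂ l≡1+k rewrite Fin.toℕ-fromℕ< k<h | Fin.toℕ-fromℕ< l<h = l≡1+k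

  private
    triple-consecutive : ∀ {S} → IsTriple S x y z → ¬ Cy x z y → Consecutive pos E S x y
    triple-consecutive {x} {y} {z} T ¬xzy =
      a∈S , b∈S , a≢b , λ w w∈S arc → ¬inside (exhaustive w∈S) (Arc⇒Cy a≢b arc)
      where
      open IsTriple T
      ¬inside : w ≡ x ⊎ w ≡ y ⊎ w ≡ z → ¬ Cy x w y
      ¬inside (inj₁ refl)        c = proj₁ (Cyclic⇒distinct c) refl
      ¬inside (inj₂ (inj₁ refl)) c = proj₁ (proj₂ (Cyclic⇒distinct c)) refl
      ¬inside (inj₂ (inj₂ refl))   = ¬xzy

  triangle⇒Adj : ∀ {S} → IsInnerFace pos E S → IsTriple S x y z → Adj E x y
  triangle⇒Adj (_ , consecutive⇒Adj , _) T with Cy-total a≢c (b≢c ∘ sym) a≢b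
    where open IsTriple T
  ... | inj₁ xzy = Adj-sym (consecutive⇒Adj _ _ (triple-consecutive (swap-IsTriple T) (Cyclic-asym xzy)))
  ... | inj₂ yzx = consecutive⇒Adj _ _ (triple-consecutive T (Cyclic-asym yzx))

  F-third : x ∈ F k → y ∈ F k → x ≢ y → ∃[ z ] IsTriple (F k) x y z
  F-third x∈ y∈ x≢y = let _ , _ , _ , T = F-triple (∈F⇒<h x∈) in IsTriple-third T x∈ y∈ x≢y

  F-Adj : x ∈ F k → y ∈ F k → x ≢ y → Adj E x y
  F-Adj x∈ y∈ x≢y = triangle⇒Adj (F-face (∈F⇒<h x∈)) (proj₂ (F-third x∈ y∈ x≢y))

  F-Dec : x ∈ F k → y ∈ F k → Dec (E x y)
  F-Dec {x} {y = y} x∈ y∈ with x Fin.≟ y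
  ... | yes refl = no ¬loop
  ... | no  x≢y  = Adj⇒Dec (F-Adj x∈ y∈ x≢y)

  record Hinge (k : ℕ) : Set where
    field
      tail head apex apex′ : Fin n
      tail→head : E tail head
      tail∈F  : tail ∈ F k
      head∈F  : head ∈ F k
      apex∈F  : apex ∈ F k
      tail∈F′ : tail ∈ F (suc k)
      head∈F′ : head ∈ F (suc k)
      apex′∈F′ : apex′ ∈ F (suc k)
      apex∉F′ : apex ∉ F (suc k)
      apex′∉F : apex′ ∉ F k
      F-exhaustive  : x ∈ F k → x ≡ tail ⊎ x ≡ head ⊎ x ≡ apex
      F′-exhaustive : x ∈ F (suc k) → x ≡ tail ⊎ x ≡ head ⊎ x ≡ apex′
      opposite : Opposite tail head apex apex′

  private
    -- one of the chords wa, wb would split the face containing a, b and r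
    ¬same-side-apex : Cy a w b → Cy a r b → w ≢ r → Adj E w a → Adj E w b →
                      a ∈ F k → b ∈ F k → r ∈ F k → ⊥
    ¬same-side-apex {a} {w} {b} {r} c₁ c₂ w≢r wa wb a∈ b∈ r∈
      with Cy-start⁻ {a} c₁ | Cy-start⁻ {a} c₂ | <-cmp (δ a w) (δ a r)
    ... | _ | _ | tri≈ _ eq _ = w≢r (δ-injective a eq)
    ... | 0<w , w<b | _ , r<b | tri< w<r _ _ =
      proj₂ (proj₂ (F-face (∈F⇒<h a∈))) w b wb
        ((r , r∈ , Cyclic⇒Arc (Cy-linear⁺ a w<r r<b)) , (a , a∈ , Cyclic⇒Arc (Cy-middle⁺ 0<w w<b)))
    ... | 0<w , w<b | 0<r , _ | tri> _ _ r<w =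
      proj₂ (proj₂ (F-face (∈F⇒<h a∈))) a w (Adj-sym wa)
        ((r , r∈ , Cyclic⇒Arc (Cy-start⁺ 0<r r<w)) , (b , b∈ , Cyclic⇒Arc (Cy-end⁺ 0<w w<b)))

  hinge : suc k < h → Hinge k
  hinge {k} 1+k<h
    with u , v , u→v , u∈F , v∈F , u∈F′ , v∈F′ ← F-share 1+k<h
    with w , T  ← F-third u∈F  v∈F  (Adj⇒≢ (inj₁ u→v))
    with r , T′ ← F-third u∈F′ v∈F′ (Adj⇒≢ (inj₁ u→v))
    = record
      { tail = u ; head = v ; apex = w ; apex′ = r ; tail→head = u→v
      ; tail∈F = u∈F ; head∈F = v∈F ; apex∈F = w∈F ; tail∈F′ = u∈F′ ; head∈F′ = v∈F′ ; apex′∈F′ = r∈F′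
      ; apex∉F′ = w∉F′ ; apex′∉F = r∉F
      ; F-exhaustive = IsTriple.exhaustive T ; F′-exhaustive = IsTriple.exhaustive T′
      ; opposite = opposite (Cy-total u≢w w≢v u≢v) (Cy-total u≢r r≢v u≢v) }
    where
    open IsTriple T  using () renaming (a≢b to u≢v; a≢c to u≢w; b≢c to v≢w; c∈S to w∈F)
    open IsTriple T′ using () renaming (a≢c to u≢r; b≢c to v≢r; c∈S to r∈F′)
    w≢v = v≢w ∘ sym
    r≢v = v≢r ∘ sym
    w≢r : w ≢ r
    w≢r refl = <-irrefl (F-injective (<-trans (n<1+n k) 1+k<h) 1+k<h (⊆-antisym F⊆F′ F′⊆F)) (n<1+n k)
      where
      F⊆F′ : F k ⊆ F (suc k)
      F⊆F′ x∈ with IsTriple.exhaustive T x∈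
      ... | inj₁ refl        = u∈F′
      ... | inj₂ (inj₁ refl) = v∈F′
      ... | inj₂ (inj₂ refl) = r∈F′
      F′⊆F : F (suc k) ⊆ F k
      F′⊆F x∈ with IsTriple.exhaustive T′ x∈
      ... | inj₁ refl        = u∈F
      ... | inj₂ (inj₁ refl) = v∈F
      ... | inj₂ (inj₂ refl) = w∈F
    w∉F′ : w ∉ F (suc k)
    w∉F′ w∈ with IsTriple.exhaustive T′ w∈
    ... | inj₁ w≡u        = u≢w (sym w≡u)
    ... | inj₂ (inj₁ w≡v) = w≢v w≡v
    ... | inj₂ (inj₂ w≡r) = w≢r w≡r
    r∉F : r ∉ F k
    r∉F r∈ with IsTriple.exhaustive T r∈
    ... | inj₁ r≡u        = u≢r (sym r≡u)
    ... | inj₂ (inj₁ r≡v) = r≢v r≡v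
    ... | inj₂ (inj₂ r≡w) = w≢r (sym r≡w)
    w-u = F-Adj w∈F u∈F (u≢w ∘ sym)
    w-v = F-Adj w∈F v∈F w≢v
    opposite : Cy u w v ⊎ Cy v w u → Cy u r v ⊎ Cy v r u → Opposite u v w r
    opposite (inj₁ uwv) (inj₁ urv) = ⊥-elim (¬same-side-apex uwv urv w≢r w-u w-v u∈F′ v∈F′ r∈F′)
    opposite (inj₁ uwv) (inj₂ vru) = inj₁ (uwv , vru)
    opposite (inj₂ vwu) (inj₁ urv) = inj₂ (vwu , urv)
    opposite (inj₂ vwu) (inj₂ vru) = ⊥-elim (¬same-side-apex vwu vru w≢r w-v w-u v∈F′ u∈F′ r∈F′)

  open Hinge

  hinge⇒<h : Hinge k → suc k < h
  hinge⇒<h H = ∈F⇒<h (tail∈F′ H)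

  Behind Ahead : Hinge k → Fin n → Set
  Behind H = ClosedSide (tail H) (head H) (apex H)
  Ahead  H = ClosedSide (tail H) (head H) (apex′ H)

  private
    ≡-drop : x ≡ a ⊎ x ≡ b ⊎ x ≡ c → x ≢ c → x ≡ a ⊎ x ≡ b
    ≡-drop (inj₁ p)        _   = inj₁ p
    ≡-drop (inj₂ (inj₁ p)) _   = inj₂ p
    ≡-drop (inj₂ (inj₂ p)) x≢c = ⊥-elim (x≢c p)

    ≡-last : x ≡ a ⊎ x ≡ b ⊎ x ≡ c → x ≢ a → x ≢ b → x ≡ c
    ≡-last (inj₁ p)        x≢a _   = ⊥-elim (x≢a p)
    ≡-last (inj₂ (inj₁ p)) _   x≢b = ⊥-elim (x≢b p)
    ≡-last (inj₂ (inj₂ p)) _   _   = p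

    ≡-pair : a ≡ u ⊎ a ≡ v → b ≡ u ⊎ b ≡ v → a ≢ b → a ≡ u × b ≡ v ⊎ a ≡ v × b ≡ u
    ≡-pair (inj₁ p) (inj₁ q) a≢b = ⊥-elim (a≢b (trans p (sym q)))
    ≡-pair (inj₁ p) (inj₂ q) _   = inj₁ (p , q)
    ≡-pair (inj₂ p) (inj₁ q) _   = inj₂ (p , q)
    ≡-pair (inj₂ p) (inj₂ q) a≢b = ⊥-elim (a≢b (trans p (sym q)))

    ¬skip : E u v → u ∈ F k → v ∈ F k → u ∈ F (suc (suc k)) → v ∈ F (suc (suc k)) → ⊥
    ¬skip {k = k} e u∈ v∈ u∈″ v∈″ =
      <-irrefl (sym (suc-injective (shared-edge⇒consecutive k<2+k e u∈ v∈ u∈″ v∈″))) (n<1+n k)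
      where k<2+k = <-trans (n<1+n k) (n<1+n (suc k))

  behind-base : (H : Hinge k) → x ∈ F k → Behind H x
  behind-base H x∈ with F-exhaustive H x∈
  ... | inj₁ x≡u        = inj₁ x≡u
  ... | inj₂ (inj₁ x≡v) = inj₂ (inj₁ x≡v)
  ... | inj₂ (inj₂ refl) =
    inj₂ (inj₂ (SameSide-refl (∈∉⇒≢ (tail∈F′ H) (apex∉F′ H)) (∈∉⇒≢ (head∈F′ H) (apex∉F′ H) ∘ sym)
                              (Adj⇒≢ (inj₁ (tail→head H)))))

  ahead-base : (H : Hinge k) → x ∈ F (suc k) → Ahead H x
  ahead-base H x∈ with F′-exhaustive H x∈
  ... | inj₁ x≡u        = inj₁ x≡u
  ... | inj₂ (inj₁ x≡v) = inj₂ (inj₁ x≡v)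
  ... | inj₂ (inj₂ refl) =
    inj₂ (inj₂ (SameSide-refl (∈∉⇒≢ (tail∈F H) (apex′∉F H)) (∈∉⇒≢ (head∈F H) (apex′∉F H) ∘ sym)
                              (Adj⇒≢ (inj₁ (tail→head H)))))

  behind-step : (H : Hinge k) (H′ : Hinge (suc k)) → Behind H x → Behind H′ x
  behind-step {k} {x} H H′ with tail H′ ∈? F k
  ... | no u′∉F = to-H′ ∘ ClosedSide-nest′ (opposite H) (≡-pair v′∈uv w′∈uv v′≢w′)
    where
    u′≡r : tail H′ ≡ apex′ H
    u′≡r = ≡-last (F′-exhaustive H (tail∈F H′)) (∈∉⇒≢ (tail∈F H) u′∉F ∘ sym) (∈∉⇒≢ (head∈F H) u′∉F ∘ sym)
    v′≢w′ = ∈∉⇒≢ (head∈F′ H′) (apex∉F′ H′)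
    v′∈uv = ≡-drop (F′-exhaustive H (head∈F H′)) (λ v′≡r → Adj⇒≢ (inj₁ (tail→head H′)) (trans u′≡r (sym v′≡r)))
    w′∈uv = ≡-drop (F′-exhaustive H (apex∈F H′)) (λ w′≡r → ∈∉⇒≢ (tail∈F′ H′) (apex∉F′ H′) (trans u′≡r (sym w′≡r)))
    to-H′ : ClosedSide (head H′) (apex′ H) (apex H′) x → Behind H′ x
    to-H′ = ClosedSide-swap ∘ subst (λ z → ClosedSide (head H′) z (apex H′) x) (sym u′≡r)
  ... | yes u′∈F = to-H′ ∘ ClosedSide-nest′ (opposite H) (≡-pair u′∈uv w′∈uv u′≢w′)
    where
    v′∉F : head H′ ∉ F k
    v′∉F v′∈F = ¬skip (tail→head H′) u′∈F v′∈F (tail∈F′ H′) (head∈F′ H′)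
    v′≡r : head H′ ≡ apex′ H
    v′≡r = ≡-last (F′-exhaustive H (head∈F H′)) (∈∉⇒≢ (tail∈F H) v′∉F ∘ sym) (∈∉⇒≢ (head∈F H) v′∉F ∘ sym)
    u′≢w′ = ∈∉⇒≢ (tail∈F′ H′) (apex∉F′ H′)
    u′∈uv = ≡-drop (F′-exhaustive H (tail∈F H′)) (λ u′≡r → Adj⇒≢ (inj₁ (tail→head H′)) (trans u′≡r (sym v′≡r)))
    w′∈uv = ≡-drop (F′-exhaustive H (apex∈F H′)) (λ w′≡r → ∈∉⇒≢ (head∈F′ H′) (apex∉F′ H′) (trans v′≡r (sym w′≡r)))
    to-H′ : ClosedSide (tail H′) (apex′ H) (apex H′) x → Behind H′ x
    to-H′ = subst (λ z → ClosedSide (tail H′) z (apex H′) x) (sym v′≡r)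

  ahead-step : (H : Hinge k) (H′ : Hinge (suc k)) → Ahead H′ x → Ahead H x
  ahead-step {k} {x} H H′ with tail H ∈? F (suc (suc k))
  ... | no u∉F″ = to-H ∘ ClosedSide-nest′ (Opposite-sym (opposite H′)) (≡-pair v∈u′v′ r∈u′v′ v≢r)
    where
    u≡w′ : tail H ≡ apex H′
    u≡w′ = ≡-last (F-exhaustive H′ (tail∈F′ H)) (∈∉⇒≢ (tail∈F′ H′) u∉F″ ∘ sym) (∈∉⇒≢ (head∈F′ H′) u∉F″ ∘ sym)
    v≢r = ∈∉⇒≢ (head∈F H) (apex′∉F H)
    v∈u′v′ = ≡-drop (F-exhaustive H′ (head∈F′ H)) (λ v≡w′ → Adj⇒≢ (inj₁ (tail→head H)) (trans u≡w′ (sym v≡w′)))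
    r∈u′v′ = ≡-drop (F-exhaustive H′ (apex′∈F′ H)) (λ r≡w′ → ∈∉⇒≢ (tail∈F H) (apex′∉F H) (trans u≡w′ (sym r≡w′)))
    to-H : ClosedSide (head H) (apex H′) (apex′ H) x → Ahead H x
    to-H = ClosedSide-swap ∘ subst (λ z → ClosedSide (head H) z (apex′ H) x) (sym u≡w′)
  ... | yes u∈F″ = to-H ∘ ClosedSide-nest′ (Opposite-sym (opposite H′)) (≡-pair u∈u′v′ r∈u′v′ u≢r)
    where
    v∉F″ : head H ∉ F (suc (suc k))
    v∉F″ v∈F″ = ¬skip (tail→head H) (tail∈F H) (head∈F H) u∈F″ v∈F″
    v≡w′ : head H ≡ apex H′
    v≡w′ = ≡-last (F-exhaustive H′ (head∈F′ H)) (∈∉⇒≢ (tail∈F′ H′) v∉F″ ∘ sym) (∈∉⇒≢ (head∈F′ H′) v∉F″ ∘ sym)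
    u≢r = ∈∉⇒≢ (tail∈F H) (apex′∉F H)
    u∈u′v′ = ≡-drop (F-exhaustive H′ (tail∈F′ H)) (λ u≡w′ → Adj⇒≢ (inj₁ (tail→head H)) (trans u≡w′ (sym v≡w′)))
    r∈u′v′ = ≡-drop (F-exhaustive H′ (apex′∈F′ H)) (λ r≡w′ → ∈∉⇒≢ (head∈F H) (apex′∉F H) (trans v≡w′ (sym r≡w′)))
    to-H : ClosedSide (tail H) (apex H′) (apex′ H) x → Ahead H x
    to-H = subst (λ z → ClosedSide (tail H) z (apex′ H) x) (sym v≡w′)

  behind : (H : Hinge l) → i ≤ l → x ∈ F i → Behind H x
  behind H i≤l x∈ with m≤n⇒m<n∨m≡n i≤l
  behind         H _ x∈ | inj₂ refl = behind-base H x∈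
  behind {suc l} H _ x∈ | inj₁ i<1+l =
    behind-step H₀ H (behind H₀ (s≤s⁻¹ i<1+l) x∈)
    where H₀ = hinge (<-trans (n<1+n (suc l)) (hinge⇒<h H))

  ahead : (H : Hinge l) → l < j → x ∈ F j → Ahead H x
  ahead {l} {j} {x} H l<j x∈ = ahead-from (j ∸ suc l) H (subst (λ i → x ∈ F i) (sym (m+[n∸m]≡n l<j)) x∈)
    where
    ahead-from : ∀ d {l} (H : Hinge l) → x ∈ F (suc l + d) → Ahead H x
    ahead-from zero    {l} H x∈ = ahead-base H (subst (λ i → x ∈ F (suc i)) (+-identityʳ l) x∈)
    ahead-from (suc d) {l} H x∈ = ahead-step H H′ (ahead-from d H′ x∈′)
      where
      x∈′ = subst (λ i → x ∈ F (suc i)) (+-suc l d) x∈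
      H′  = hinge (≤-<-trans (s≤s (s≤s (m≤m+n l d))) (∈F⇒<h x∈′))

  behind-ahead⇒shared : (H : Hinge k) → Behind H x → Ahead H x → x ∈ F k × x ∈ F (suc k)
  behind-ahead⇒shared H (inj₁ refl)        _                  = tail∈F H , tail∈F′ H
  behind-ahead⇒shared H (inj₂ (inj₁ refl)) _                  = head∈F H , head∈F′ H
  behind-ahead⇒shared H (inj₂ (inj₂ _))    (inj₁ refl)        = tail∈F H , tail∈F′ H
  behind-ahead⇒shared H (inj₂ (inj₂ _))    (inj₂ (inj₁ refl)) = head∈F H , head∈F′ H
  behind-ahead⇒shared H (inj₂ (inj₂ s₁))   (inj₂ (inj₂ s₂))   = ⊥-elim (SameSide-Opposite s₁ s₂ (opposite H))

  -- vertices of earlier faces lie behind every later hinge edge, those of later faces ahead of it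
  ∈F-interval : x ∈ F i → x ∈ F j → i ≤ l → l < j → x ∈ F l × x ∈ F (suc l)
  ∈F-interval x∈i x∈j i≤l l<j = behind-ahead⇒shared H (behind H i≤l x∈i) (ahead H l<j x∈j)
    where H = hinge (≤-<-trans l<j (∈F⇒<h x∈j))

  private
    in-range : (k<h : k < h) → i ≤ k → k ≤ j → InRange E f i j (fromℕ< k<h)
    in-range k<h rewrite Fin.toℕ-fromℕ< k<h = _,_

  VertF⁺ : i ≤ k → k ≤ j → x ∈ F k → VertF E f i j x
  VertF⁺ i≤k k≤j x∈ = let k<h = ∈F⇒<h x∈ in fromℕ< k<h , in-range k<h i≤k k≤j , ∈F⇒∈f k<h x∈

  VertF⁻ : VertF E f i j x → ∃[ k ] (i ≤ k × k ≤ j × x ∈ F k)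
  VertF⁻ {x = x} (k , (i≤k , k≤j) , x∈) = toℕ k , i≤k , k≤j , subst (x ∈_) (sym (F-toℕ k)) x∈

  EdgeF⁺ : E x y → i ≤ k → k ≤ j → x ∈ F k → y ∈ F k → EdgeF E f i j x y
  EdgeF⁺ x→y i≤k k≤j x∈ y∈ = let k<h = ∈F⇒<h x∈ in
    x→y , fromℕ< k<h , in-range k<h i≤k k≤j , ∈F⇒∈f k<h x∈ , ∈F⇒∈f k<h y∈

  EdgeF⁻ : EdgeF E f i j x y → E x y × ∃[ k ] (i ≤ k × k ≤ j × x ∈ F k × y ∈ F k)
  EdgeF⁻ {x = x} {y} (x→y , k , (i≤k , k≤j) , x∈ , y∈) =
    x→y , toℕ k , i≤k , k≤j , subst (x ∈_) (sym (F-toℕ k)) x∈ , subst (y ∈_) (sym (F-toℕ k)) y∈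

  InnerEdgeF⁺ : E x y → i ≤ k → k ≤ j → i ≤ l → l ≤ j → k ≢ l →
                x ∈ F k → y ∈ F k → x ∈ F l → y ∈ F l → InnerEdgeF E f i j x y
  InnerEdgeF⁺ x→y i≤k k≤j i≤l l≤j k≢l x∈k y∈k x∈l y∈l =
    let k<h = ∈F⇒<h x∈k ; l<h = ∈F⇒<h x∈l in
    x→y , fromℕ< k<h , fromℕ< l<h , in-range k<h i≤k k≤j , in-range l<h i≤l l≤j ,
    (λ eq → k≢l (trans (sym (Fin.toℕ-fromℕ< k<h)) (trans (cong toℕ eq) (Fin.toℕ-fromℕ< l<h)))) ,
    ∈F⇒∈f k<h x∈k , ∈F⇒∈f k<h y∈k , ∈F⇒∈f l<h x∈l , ∈F⇒∈f l<h y∈l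

  InnerEdgeF⁻ : InnerEdgeF E f i j x y →
                E x y × ∃[ k ] ∃[ l ] (i ≤ k × k ≤ j × i ≤ l × l ≤ j × k ≢ l ×
                                       x ∈ F k × y ∈ F k × x ∈ F l × y ∈ F l)
  InnerEdgeF⁻ {x = x} {y} (x→y , k , l , (i≤k , k≤j) , (i≤l , l≤j) , k≢l , x∈k , y∈k , x∈l , y∈l) =
    x→y , toℕ k , toℕ l , i≤k , k≤j , i≤l , l≤j , k≢l ∘ Fin.toℕ-injective ,
    on k x∈k , on k y∈k , on l x∈l , on l y∈l
    where
    on : ∀ {z} (k : Fin h) → z ∈ f k → z ∈ F (toℕ k)
    on {z} k = subst (z ∈_) (sym (F-toℕ k))

  VertF-weaken : j ≤ l → VertF E f i j x → VertF E f i l x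
  VertF-weaken j≤l (k , (i≤k , k≤j) , x∈) = k , (i≤k , ≤-trans k≤j j≤l) , x∈

  EdgeF-weaken : j ≤ l → EdgeF E f i j x y → EdgeF E f i l x y
  EdgeF-weaken j≤l (x→y , k , (i≤k , k≤j) , x∈ , y∈) = x→y , k , (i≤k , ≤-trans k≤j j≤l) , x∈ , y∈

  VertF-split : VertF E f i (suc j) x → VertF E f i j x ⊎ x ∈ F (suc j)
  VertF-split x∈ with k , i≤k , k≤1+j , x∈k ← VertF⁻ x∈ with m≤n⇒m<n∨m≡n k≤1+j
  ... | inj₁ k<1+j = inj₁ (VertF⁺ i≤k (s≤s⁻¹ k<1+j) x∈k)
  ... | inj₂ refl  = inj₂ x∈k

  EdgeF-split : EdgeF E f i (suc j) x y → EdgeF E f i j x y ⊎ (E x y × x ∈ F (suc j) × y ∈ F (suc j))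
  EdgeF-split x→y∈ with x→y , k , i≤k , k≤1+j , x∈k , y∈k ← EdgeF⁻ x→y∈ with m≤n⇒m<n∨m≡n k≤1+j
  ... | inj₁ k<1+j = inj₁ (EdgeF⁺ x→y i≤k (s≤s⁻¹ k<1+j) x∈k y∈k)
  ... | inj₂ refl  = inj₂ (x→y , x∈k , y∈k)

  apex′∉earlier : (H : Hinge k) → j ≤ k → apex′ H ∉ F j
  apex′∉earlier H j≤k r∈ = apex′∉F H (proj₁ (∈F-interval r∈ (apex′∈F′ H) j≤k (n<1+n _)))

  tail-apex′ : (H : Hinge k) → Adj E (tail H) (apex′ H)
  tail-apex′ H = F-Adj (tail∈F′ H) (apex′∈F′ H) (∈∉⇒≢ (tail∈F H) (apex′∉F H))

  head-apex′ : (H : Hinge k) → Adj E (head H) (apex′ H)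
  head-apex′ H = F-Adj (head∈F′ H) (apex′∈F′ H) (∈∉⇒≢ (head∈F H) (apex′∉F H))

  shared⇒tail-or-head : (H : Hinge k) → x ∈ F k → x ∈ F (suc k) → x ≡ tail H ⊎ x ≡ head H
  shared⇒tail-or-head H x∈ x∈′ = ≡-drop (F-exhaustive H x∈) (λ x≡w → apex∉F′ H (subst (_∈ _) x≡w x∈′))

  shared-edge⇒hinge-edge : (H : Hinge k) → E x y → x ∈ F k → y ∈ F k → x ∈ F (suc k) → y ∈ F (suc k) →
                           x ≡ tail H × y ≡ head H
  shared-edge⇒hinge-edge H x→y x∈ y∈ x∈′ y∈′ with shared⇒tail-or-head H x∈ x∈′ | shared⇒tail-or-head H y∈ y∈′
  ... | inj₁ x≡u  | inj₂ y≡v  = x≡u , y≡v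
  ... | inj₁ refl | inj₁ refl = ⊥-elim (¬loop x→y)
  ... | inj₂ refl | inj₁ refl = ⊥-elim (¬2-cycle x→y (tail→head H))
  ... | inj₂ refl | inj₂ refl = ⊥-elim (¬loop x→y)

module ChordFace {n : ℕ} {E : Fin n → Fin n → Set} {pos : Fin n → Fin n}
                 (acyclic : Acyclic E) (drawing : OuterplanarDrawing pos E)
                 (biconnected : Biconnected E) (E? : ∀ u v → Dec (E u v)) where

  open Outerplanar acyclic drawing

  private
    variable
      a b c e p q x y z : Fin n

  Adj? : ∀ u v → Dec (Adj E u v)
  Adj? u v = E? u v ⊎-dec E? v u

  private
    has-neighbour : a ≢ b → ∃[ c ] Adj E b c
    has-neighbour {a} {b} a≢b with proj₁ (proj₂ biconnected) b a
    ... | ε       = ⊥-elim (a≢b refl)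
    ... | b-c ◅ _ = _ , b-c

    furthest⇒separates : ∀ {m} → Adj E b m → (∀ {y} → Adj E b y → δ b y ≤ δ b m) →
                         δ b m < δ b a → ¬ Star (AdjAvoid E m) b a
    furthest⇒separates {b} {a} {m} b-m furthest m<a path = <-asym m<a (reach path b<m)
      where
      0<m : 0 < δ b m
      0<m = δ-pos b (Adj⇒≢ b-m ∘ sym)
      b<m : δ b b < δ b m
      b<m = subst (_< δ b m) (sym (δ-self b)) 0<m
      step : AdjAvoid E m y z → δ b y < δ b m → δ b z < δ b m
      step {y} {z} (y-z , y≢m , z≢m) y<m with <-cmp (δ b z) (δ b m)
      ... | tri< z<m _ _ = z<m
      ... | tri≈ _ z≡m _ = ⊥-elim (z≢m (δ-injective b z≡m))
      ... | tri> _ _ m<z with y Fin.≟ b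
      ...   | yes refl = ⊥-elim (<⇒≱ m<z (furthest y-z))
      ...   | no  y≢b  = ⊥-elim (¬crossing b-m y-z (Cy-start⁺ (δ-pos b y≢b) y<m) (Cy-end⁺ 0<m m<z))
      reach = fold (λ y z → δ b y < δ b m → δ b z < δ b m) (λ y-z k → k ∘ step y-z) (λ y<m → y<m)

  -- the neighbour of b furthest clockwise from b would be a cut vertex separating b from a
  empty-arc⇒Adj : a ≢ b → (∀ x → ¬ Cy a x b) → Adj E a b
  empty-arc⇒Adj {a} {b} a≢b empty with Adj? a b
  ... | yes a-b = a-b
  ... | no ¬a-b
    with m , b-m , furthest ← argmax-Fin (Adj? b) (δ b) (has-neighbour a≢b)
    = ⊥-elim (furthest⇒separates b-m furthest m<a (proj₂ (proj₂ biconnected) m b a (Adj⇒≢ b-m) a≢m))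
    where
    a≢m : a ≢ m
    a≢m a≡m = ¬a-b (Adj-sym (subst (Adj E b) (sym a≡m) b-m))
    m<a : δ b m < δ b a
    m<a with Cy-total (Adj⇒≢ b-m) (a≢m ∘ sym) (a≢b ∘ sym)
    ... | inj₁ bma = proj₂ (Cy-start⁻ bma)
    ... | inj₂ amb = ⊥-elim (empty _ amb)

  private
    module Construction {p q x₀ : Fin n} (p-q : Adj E p q) (p-x₀-q : Cy p x₀ q) where

      -- positions measured clockwise from p: the open arc from p to q is 0 < d z < ℓ
      d : Fin n → ℕ
      d = δ p

      ℓ : ℕ
      ℓ = d q

      Hides : Fin n → Fin n → Fin n → Set
      Hides a b z = Adj E a b × d a < d z × d z < d b × d b ≤ ℓ × ¬ (a ≡ p × b ≡ q)

      Hides? : ∀ a b z → Dec (Hides a b z)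
      Hides? a b z = Adj? a b ×-dec d a <? d z ×-dec d z <? d b ×-dec d b ≤? ℓ
                     ×-dec ¬? ((a Fin.≟ p) ×-dec (b Fin.≟ q))

      Hidden : Fin n → Set
      Hidden z = ∃[ a ] ∃[ b ] Hides a b z

      Hidden? : ∀ z → Dec (Hidden z)
      Hidden? z = any? λ a → any? λ b → Hides? a b z

      Visible : Fin n → Set
      Visible z = 0 < d z × d z < ℓ × ¬ Hidden z

      OnFace : Fin n → Set
      OnFace z = z ≡ p ⊎ z ≡ q ⊎ Visible z

      OnFace? : ∀ z → Dec (OnFace z)
      OnFace? z = z Fin.≟ p ⊎-dec z Fin.≟ q ⊎-dec (0 <? d z ×-dec d z <? ℓ ×-dec ¬? (Hidden? z))

      S : Subset n
      S = subset OnFace?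

      d-p≤ : ∀ z → d p ≤ d z
      d-p≤ z = subst (_≤ d z) (sym (δ-self p)) z≤n

      0<d⇒≢p : 0 < d z → z ≢ p
      0<d⇒≢p {z} 0<z refl = <-irrefl (sym (δ-self p)) 0<z

      <ℓ⇒≢q : d z < ℓ → z ≢ q
      <ℓ⇒≢q z<ℓ refl = <-irrefl refl z<ℓ

      OnFace⇒≤ℓ : OnFace z → d z ≤ ℓ
      OnFace⇒≤ℓ (inj₁ refl)                = d-p≤ q
      OnFace⇒≤ℓ (inj₂ (inj₁ refl))         = ≤-refl
      OnFace⇒≤ℓ (inj₂ (inj₂ (_ , z<ℓ , _))) = <⇒≤ z<ℓ

      ¬OnFace⇒0<d : ¬ OnFace z → 0 < d z
      ¬OnFace⇒0<d ¬on = δ-pos p (¬on ∘ inj₁)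

      inner⇒Hidden : 0 < d z → d z < ℓ → ¬ OnFace z → Hidden z
      inner⇒Hidden {z} 0<z z<ℓ ¬on with Hidden? z
      ... | yes hidden = hidden
      ... | no ¬hidden = ⊥-elim (¬on (inj₂ (inj₂ (0<z , z<ℓ , ¬hidden))))

      ¬crossing-d : Adj E a b → Adj E c e → d a < d c → d c < d b → d b < d e → ⊥
      ¬crossing-d a-b c-e a<c c<b b<e =
        ¬crossing a-b c-e (Cy-linear⁺ p a<c c<b) (δ⇒Cy p (inj₂ (inj₂ (<-trans a<c c<b , b<e))))

      μ : Fin n → Fin n → ℕ
      μ a b = d a + (ℓ ∸ d b)

      hider-of-left-end : Hides a b z → Hides c e a → Hides c e z × μ c e < μ a b
      hider-of-left-end {a} {b} {z} {c} {e} (a-b , a<z , z<b , b≤ℓ , _) (c-e , c<a , a<e , e≤ℓ , ¬ce≡pq) =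
        (c-e , <-trans c<a a<z , <-≤-trans z<b b≤e , e≤ℓ , ¬ce≡pq) , +-mono-<-≤ c<a (∸-monoʳ-≤ ℓ b≤e)
        where
        b≤e : d b ≤ d e
        b≤e = ≮⇒≥ λ e<b → ¬crossing-d c-e a-b c<a a<e e<b

      hider-of-right-end : Hides a b z → Hides c e b → Hides c e z × μ c e < μ a b
      hider-of-right-end {a} {b} {z} {c} {e} (a-b , a<z , z<b , b≤ℓ , _) (c-e , c<b , b<e , e≤ℓ , ¬ce≡pq) =
        (c-e , ≤-<-trans c≤a a<z , <-trans z<b b<e , e≤ℓ , ¬ce≡pq) , +-mono-≤-< c≤a (∸-monoʳ-< b<e e≤ℓ)
        where
        c≤a : d c ≤ d a
        c≤a = ≮⇒≥ λ a<c → ¬crossing-d a-b c-e a<c c<b b<e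

      -- a hider of minimal μ has both ends on the face: a hidden end could be replaced by its own hider
      Hidden⇒face-hider : Hidden z → ∃[ a ] ∃[ b ] (Hides a b z × OnFace a × OnFace b)
      Hidden⇒face-hider {z} (a , b , H)
        with N , (a , b , H , refl) , below ←
             least (λ N → any? λ a → any? λ b → Hides? a b z ×-dec μ a b ≟ N) (a , b , H , refl)
        = a , b , H , on-a , on-b
        where
        a<z = proj₁ (proj₂ H)
        z<b = proj₁ (proj₂ (proj₂ H))
        b≤ℓ = proj₁ (proj₂ (proj₂ (proj₂ H)))
        smaller : ∀ {c e} → Hides c e z × μ c e < μ a b → ⊥
        smaller {c} {e} (H′ , μ<) = below μ< (c , e , H′ , refl)
        on-a : OnFace a
        on-a with OnFace? a
        ... | yes on = on
        ... | no ¬on = let c , e , H′ = inner⇒Hidden (¬OnFace⇒0<d ¬on) (<-≤-trans (<-trans a<z z<b) b≤ℓ) ¬on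
                       in ⊥-elim (smaller (hider-of-left-end H H′))
        on-b : OnFace b
        on-b with OnFace? b
        ... | yes on = on
        ... | no ¬on = let b<ℓ = ≤∧≢⇒< b≤ℓ (λ b≡ℓ → ¬on (inj₂ (inj₁ (δ-injective p b≡ℓ))))
                           c , e , H′ = inner⇒Hidden (¬OnFace⇒0<d ¬on) b<ℓ ¬on
                       in ⊥-elim (smaller (hider-of-right-end H H′))

      0<x₀ = proj₁ (Cy-start⁻ p-x₀-q)
      x₀<ℓ = proj₂ (Cy-start⁻ p-x₀-q)

      OnFace⇒Visible : OnFace z → z ≢ p → z ≢ q → Visible z
      OnFace⇒Visible (inj₁ z≡p)        z≢p _   = ⊥-elim (z≢p z≡p)
      OnFace⇒Visible (inj₂ (inj₁ z≡q)) _   z≢q = ⊥-elim (z≢q z≡q)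
      OnFace⇒Visible (inj₂ (inj₂ vis)) _   _   = vis

      visible : ∃[ y ] Visible y
      visible with OnFace? x₀
      ... | yes on-x₀ = x₀ , OnFace⇒Visible on-x₀ (0<d⇒≢p 0<x₀) (<ℓ⇒≢q x₀<ℓ)
      ... | no ¬on-x₀ with a , b , (_ , a<x₀ , x₀<b , b≤ℓ , ¬ab≡pq) , on-a , on-b
                             ← Hidden⇒face-hider (inner⇒Hidden 0<x₀ x₀<ℓ ¬on-x₀)
                      with a Fin.≟ p
      ...   | no  a≢p  = a , OnFace⇒Visible on-a a≢p (<ℓ⇒≢q (<-≤-trans (<-trans a<x₀ x₀<b) b≤ℓ))
      ...   | yes refl = b , OnFace⇒Visible on-b (0<d⇒≢p (≤-<-trans z≤n (<-trans a<x₀ x₀<b)))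
                                                  (λ b≡q → ¬ab≡pq (refl , b≡q))

      p∈S : p ∈ S
      p∈S = ∈-subset⁺ OnFace? (inj₁ refl)

      q∈S : q ∈ S
      q∈S = ∈-subset⁺ OnFace? (inj₂ (inj₁ refl))

      3≤∣S∣′ : 3 ≤ ∣ S ∣
      3≤∣S∣′ = let y , 0<y , y<ℓ , _ = visible in
        3≤∣S∣ p∈S q∈S (∈-subset⁺ OnFace? (inj₂ (inj₂ (proj₂ visible))))
              (Adj⇒≢ p-q) (0<d⇒≢p 0<y ∘ sym) (<ℓ⇒≢q y<ℓ ∘ sym)

      0<ℓ : 0 < ℓ
      0<ℓ = <-trans 0<x₀ x₀<ℓ

      face-hider-ends : a ∈ S → b ∈ S → (∀ x → x ∈ S → ¬ Cy a x b) → d a < d z → d z < d b →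
                        Hides c e z → OnFace c → OnFace e → c ≡ a × e ≡ b
      face-hider-ends {a} {b} {z} {c} {e} a∈S b∈S empty a<z z<b (c-e , c<z , z<e , e≤ℓ , ¬ce≡pq) on-c on-e =
        left , right
        where
        on-a = ∈-subset⁻ OnFace? a∈S
        on-b = ∈-subset⁻ OnFace? b∈S
        left : c ≡ a
        left with <-cmp (d c) (d a)
        ... | tri≈ _ c≡a _ = δ-injective p c≡a
        ... | tri> _ _ a<c = ⊥-elim (empty c (∈-subset⁺ OnFace? on-c) (Cy-linear⁺ p a<c (<-trans c<z z<b)))
        ... | tri< c<a _ _ = ⊥-elim (¬on-face on-a)
          where
          ¬on-face : ¬ OnFace a
          ¬on-face (inj₁ refl)        = <-irrefl refl (<-≤-trans c<a (d-p≤ c))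
          ¬on-face (inj₂ (inj₁ refl)) = <-irrefl refl (<-≤-trans (<-trans a<z z<b) (OnFace⇒≤ℓ on-b))
          ¬on-face (inj₂ (inj₂ (_ , _ , ¬hidden))) = ¬hidden (c , e , c-e , c<a , <-trans a<z z<e , e≤ℓ , ¬ce≡pq)
        right : e ≡ b
        right with <-cmp (d e) (d b)
        ... | tri≈ _ e≡b _ = δ-injective p e≡b
        ... | tri< e<b _ _ = ⊥-elim (empty e (∈-subset⁺ OnFace? on-e) (Cy-linear⁺ p (<-trans a<z z<e) e<b))
        ... | tri> _ _ b<e = ⊥-elim (¬on-face on-b)
          where
          ¬on-face : ¬ OnFace b
          ¬on-face (inj₁ refl)        = <-irrefl refl (<-≤-trans (<-trans a<z z<b) (d-p≤ a))
          ¬on-face (inj₂ (inj₁ refl)) = <-irrefl refl (<-≤-trans b<e e≤ℓ)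
          ¬on-face (inj₂ (inj₂ (_ , _ , ¬hidden))) = ¬hidden (c , e , c-e , <-trans c<z z<b , b<e , e≤ℓ , ¬ce≡pq)

      between⇒Adj : a ∈ S → b ∈ S → (∀ x → x ∈ S → ¬ Cy a x b) → d a < d z → d z < d b → Adj E a b
      between⇒Adj {a} {b} {z} a∈S b∈S empty a<z z<b =
        face-hider⇒Adj (Hidden⇒face-hider (inner⇒Hidden 0<z z<ℓ ¬on-z))
        where
        face-hider⇒Adj : ∃[ c ] ∃[ e ] (Hides c e z × OnFace c × OnFace e) → Adj E a b
        face-hider⇒Adj (c , e , H , on-c , on-e)
          with refl , refl ← face-hider-ends a∈S b∈S empty a<z z<b H on-c on-e = proj₁ H
        0<z = ≤-<-trans z≤n a<z
        z<ℓ = <-≤-trans z<b (OnFace⇒≤ℓ (∈-subset⁻ OnFace? b∈S))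
        ¬on-z : ¬ OnFace z
        ¬on-z on-z = empty z (∈-subset⁺ OnFace? on-z) (Cy-linear⁺ p a<z z<b)

      consecutive⇒Adj : Consecutive pos E S a b → Adj E a b
      consecutive⇒Adj {a} {b} (a∈S , b∈S , a≢b , no-arc) with <-cmp (d a) (d b)
      ... | tri≈ _ a≡b _ = ⊥-elim (a≢b (δ-injective p a≡b))
      ... | tri< a<b _ _ with any? (λ z → d a <? d z ×-dec d z <? d b)
      ...   | no ¬between    = empty-arc⇒Adj a≢b (λ x axb → ¬between (x , Cy-linear⁻ p a<b axb))
      ...   | yes (z , a<z , z<b) = between⇒Adj a∈S b∈S (λ x x∈S → no-arc x x∈S ∘ Cyclic⇒Arc) a<z z<b
      consecutive⇒Adj {a} {b} (a∈S , b∈S , a≢b , no-arc) | tri> _ _ b<a with a Fin.≟ q | b Fin.≟ p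
      ... | yes refl | yes refl = Adj-sym p-q
      ... | no  a≢q  | _        =
        ⊥-elim (no-arc q q∈S (Cyclic⇒Arc (δ⇒Cy p (inj₂ (inj₂ (b<a , a<ℓ))))))
        where a<ℓ = ≤∧≢⇒< (OnFace⇒≤ℓ (∈-subset⁻ OnFace? a∈S)) (a≢q ∘ δ-injective p)
      ... | yes refl | no  b≢p  = ⊥-elim (no-arc p p∈S (Cyclic⇒Arc (Cy-middle⁺ (δ-pos p b≢p) b<a)))

      split-below : d a < d b → d b ≤ ℓ → Adj E a b → OnFace x → OnFace y → Cy a x b → Cy b y a → ⊥
      split-below {a} {b} a<b b≤ℓ a-b on-x on-y c₁ c₂ with (a Fin.≟ p) ×-dec (b Fin.≟ q)
      ... | yes (refl , refl) = <-irrefl refl (<-≤-trans (proj₂ (Cy-end⁻ c₂)) (OnFace⇒≤ℓ on-y))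
      ... | no ¬ab≡pq =
        let a<x , x<b = Cy-linear⁻ p a<b c₁
            _ , _ , ¬hidden = OnFace⇒Visible on-x (0<d⇒≢p (≤-<-trans z≤n a<x)) (<ℓ⇒≢q (<-≤-trans x<b b≤ℓ))
        in ¬hidden (a , b , a-b , a<x , x<b , b≤ℓ , ¬ab≡pq)

      split-above : ℓ < d a → ℓ < d b → OnFace x → OnFace y → Cy a x b → Cy b y a → ⊥
      split-above ℓ<a ℓ<b on-x on-y c₁ c₂ with Cy⇒δ p c₁ | Cy⇒δ p c₂
      ... | inj₁ (a<x , _)        | _                     = <-asym a<x x<a
        where x<a = ≤-<-trans (OnFace⇒≤ℓ on-x) ℓ<a
      ... | inj₂ (inj₂ (_ , a<x)) | _                     = <-asym a<x x<a
        where x<a = ≤-<-trans (OnFace⇒≤ℓ on-x) ℓ<a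
      ... | inj₂ (inj₁ (_ , b<a)) | inj₁ (b<y , _)        = <-asym b<y y<b
        where y<b = ≤-<-trans (OnFace⇒≤ℓ on-y) ℓ<b
      ... | inj₂ (inj₁ (_ , b<a)) | inj₂ (inj₁ (_ , a<b)) = <-asym a<b b<a
      ... | inj₂ (inj₁ (_ , b<a)) | inj₂ (inj₂ (a<b , _)) = <-asym a<b b<a

      split-across : d a ≤ ℓ → ℓ < d b → Adj E a b → OnFace x → OnFace y → Cy a x b → Cy b y a → ⊥
      split-across {a} {b} a≤ℓ ℓ<b a-b on-x on-y c₁ c₂ with a Fin.≟ p | a Fin.≟ q
      ... | yes refl | _        = <-asym (<-≤-trans (proj₂ (Cy-end⁻ c₂)) (OnFace⇒≤ℓ on-y)) ℓ<b
      ... | no _     | yes refl with Cy⇒δ p c₁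
      ...   | inj₁ (ℓ<x , _)        = <-irrefl refl (<-≤-trans ℓ<x (OnFace⇒≤ℓ on-x))
      ...   | inj₂ (inj₁ (_ , b<ℓ)) = <-asym b<ℓ ℓ<b
      ...   | inj₂ (inj₂ (b<ℓ , _)) = <-asym b<ℓ ℓ<b
      split-across {a} {b} a≤ℓ ℓ<b a-b on-x on-y c₁ c₂ | no a≢p | no a≢q =
        ¬crossing p-q a-b (Cy-start⁺ (δ-pos p a≢p) (≤∧≢⇒< a≤ℓ (a≢q ∘ δ-injective p))) (Cy-end⁺ 0<ℓ ℓ<b)

      ¬split : Adj E a b → OnFace x → OnFace y → Cy a x b → Cy b y a → ⊥
      ¬split {a} {b} a-b on-x on-y c₁ c₂ with d a ≤? ℓ | d b ≤? ℓ
      ... | yes a≤ℓ | yes b≤ℓ with <-cmp (d a) (d b)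
      ...   | tri< a<b _ _ = split-below a<b b≤ℓ a-b on-x on-y c₁ c₂
      ...   | tri≈ _ a≡b _ = Adj⇒≢ a-b (δ-injective p a≡b)
      ...   | tri> _ _ b<a = split-below b<a a≤ℓ (Adj-sym a-b) on-y on-x c₂ c₁
      ¬split a-b on-x on-y c₁ c₂ | yes a≤ℓ | no b≰ℓ = split-across a≤ℓ (≰⇒> b≰ℓ) a-b on-x on-y c₁ c₂
      ¬split a-b on-x on-y c₁ c₂ | no a≰ℓ | yes b≤ℓ = split-across b≤ℓ (≰⇒> a≰ℓ) (Adj-sym a-b) on-y on-x c₂ c₁
      ¬split a-b on-x on-y c₁ c₂ | no a≰ℓ | no b≰ℓ = split-above (≰⇒> a≰ℓ) (≰⇒> b≰ℓ) on-x on-y c₁ c₂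

      S-face : IsInnerFace pos E S
      S-face = 3≤∣S∣′ , (λ _ _ → consecutive⇒Adj) , λ a b a-b ((x , x∈S , arc₁) , (y , y∈S , arc₂)) →
        ¬split a-b (∈-subset⁻ OnFace? x∈S) (∈-subset⁻ OnFace? y∈S)
               (Arc⇒Cy (Adj⇒≢ a-b) arc₁) (Arc⇒Cy (Adj⇒≢ a-b ∘ sym) arc₂)

  chord-face : Adj E p q → Cy p x q → ∃[ S ] (IsInnerFace pos E S × p ∈ S × q ∈ S)
  chord-face p-q p-x-q = S , S-face , p∈S , q∈S
    where open Construction p-q p-x-q

module Covering {n : ℕ} {E : Fin n → Fin n → Set} {pos : Fin n → Fin n}
                (acyclic : Acyclic E) (drawing : OuterplanarDrawing pos E) (biconnected : Biconnected E)
                (triangulated : InternallyTriangulated pos E)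
                {h : ℕ} {f : Fin h → Subset n} (ordering : FaceOrdering pos E h f) where

  open Outerplanar acyclic drawing
  open Faces acyclic drawing triangulated ordering

  private
    variable
      u v : Fin n

    edge-on-face-with : (∀ a b → Dec (E a b)) → E u v → ∃[ k ] (u ∈ F k × v ∈ F k)
    edge-on-face-with {u} {v} E? u→v
      with x , x≢u , x≢v ← ∃-distinct-from (proj₁ biconnected) u v
      with Cy-total (x≢u ∘ sym) x≢v (Adj⇒≢ (inj₁ u→v))
    ... | inj₁ uxv = let _ , S-face , u∈S , v∈S = chord-face (inj₁ u→v) uxv in face⇒F S-face u∈S v∈S
      where open ChordFace acyclic drawing biconnected E?
    ... | inj₂ vxu = let _ , S-face , v∈S , u∈S = chord-face (inj₂ u→v) vxu in face⇒F S-face u∈S v∈S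
      where open ChordFace acyclic drawing biconnected E?

  -- E need not be decidable; excluded middle for it is available under a double negation,
  -- which suffices because the goal is decidable
  edge-on-face : E u v → ∃[ k ] (u ∈ F k × v ∈ F k)
  edge-on-face {u} {v} u→v with any? (λ i → (u ∈? f i) ×-dec (v ∈? f i))
  ... | yes (i , u∈ , v∈) = toℕ i , subst (u ∈_) (sym (F-toℕ i)) u∈ , subst (v ∈_) (sym (F-toℕ i)) v∈
  ... | no ¬on-f = ⊥-elim (¬¬-∀-Fin (λ a → ¬¬-∀-Fin (λ b → ¬¬-excluded-middle)) λ E? →
                     ¬on-f (on-f (edge-on-face-with E? u→v)))
    where
    on-f : ∃[ k ] (u ∈ F k × v ∈ F k) → ∃[ i ] (u ∈ f i × v ∈ f i)
    on-f (k , u∈ , v∈) = let k<h = ∈F⇒<h u∈ in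
      fromℕ< k<h , subst (u ∈_) (F≡f k<h) u∈ , subst (v ∈_) (F≡f k<h) v∈

  vertex-on-face : ∀ v → ∃[ k ] v ∈ F k
  vertex-on-face v with x , x≢v , _ ← ∃-distinct-from (proj₁ biconnected) v v
                   with proj₁ (proj₂ biconnected) v x
  ... | ε = ⊥-elim (x≢v refl)
  ... | inj₁ v→y ◅ _ = let k , v∈ , _ = edge-on-face v→y in k , v∈
  ... | inj₂ y→v ◅ _ = let k , _ , v∈ = edge-on-face y→v in k , v∈

module Decomposition {n : ℕ} {E : Fin n → Fin n → Set} {s t : Fin n} {pos : Fin n → Fin n}
                     (st-dag : STDAG E s t) (drawing : OuterplanarDrawing pos E)
                     (biconnected : Biconnected E) (triangulated : InternallyTriangulated pos E)
                     {h : ℕ} {f : Fin h → Subset n} (ordering : FaceOrdering pos E h f)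
                     (s∈f₀ : ∃[ i ] (toℕ i ≡ 0 × s ∈ f i)) where

  open Outerplanar (proj₁ st-dag) drawing
  open Faces (proj₁ st-dag) drawing triangulated ordering
  open Covering (proj₁ st-dag) drawing biconnected triangulated ordering
  open Hinge

  private
    variable
      a b c i j k l : ℕ
      p q w x y z : Fin n

  E-in-F? : ∀ (i : Fin h) → p ∈ f i → q ∈ f i → Dec (E p q)
  E-in-F? i p∈ q∈ = F-Dec (subst (_ ∈_) (sym (F-toℕ i)) p∈) (subst (_ ∈_) (sym (F-toℕ i)) q∈)

  VertF? : ∀ a b v → Dec (VertF E f a b v)
  VertF? a b v = any? λ i → (a ≤? toℕ i ×-dec toℕ i ≤? b) ×-dec v ∈? f i

  EdgeF? : ∀ a b u v → Dec (EdgeF E f a b u v)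
  EdgeF? a b u v with any? (λ i → (a ≤? toℕ i ×-dec toℕ i ≤? b) ×-dec u ∈? f i ×-dec v ∈? f i)
  ... | no ¬face = no (¬face ∘ proj₂)
  ... | yes face@(i , _ , u∈ , v∈) with E-in-F? i u∈ v∈
  ...   | yes u→v = yes (u→v , face)
  ...   | no ¬u→v = no (¬u→v ∘ proj₁)

  InnerEdgeF? : ∀ a b u v → Dec (InnerEdgeF E f a b u v)
  InnerEdgeF? a b u v with any? (λ i → any? λ j →
                             (a ≤? toℕ i ×-dec toℕ i ≤? b) ×-dec (a ≤? toℕ j ×-dec toℕ j ≤? b)
                             ×-dec ¬? (i Fin.≟ j)
                             ×-dec u ∈? f i ×-dec v ∈? f i ×-dec u ∈? f j ×-dec v ∈? f j)
  ... | no ¬faces = no (¬faces ∘ proj₂)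
  ... | yes faces@(i , _ , _ , _ , _ , u∈ , v∈ , _) with E-in-F? i u∈ v∈
  ...   | yes u→v = yes (u→v , faces)
  ...   | no ¬u→v = no (¬u→v ∘ proj₁)

  IsFan? : ∀ a b x y → Dec (IsFan E f a b x y)
  IsFan? a b x y =
    VertF? a b x ×-dec all? (λ u → ¬? (EdgeF? a b u x))
    ×-dec all? (λ v → VertF? a b v →-dec all? (λ u → ¬? (EdgeF? a b u v)) →-dec v Fin.≟ x)
    ×-dec VertF? a b y ×-dec all? (λ w → ¬? (EdgeF? a b y w))
    ×-dec all? (λ v → VertF? a b v →-dec all? (λ w → ¬? (EdgeF? a b v w)) →-dec v Fin.≟ y)
    ×-dec all? (λ u → all? λ v → InnerEdgeF? a b u v →-dec (u Fin.≟ x ⊎-dec v Fin.≟ x))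

  Fan? : ∀ a b → Dec (∃[ x ] ∃[ y ] IsFan E f a b x y)
  Fan? a b = any? λ x → any? λ y → IsFan? a b x y

  private
    only-face : k ≤ l → l ≤ k → z ∈ F l → z ∈ F k
    only-face {z = z} k≤l l≤k = subst (λ i → z ∈ F i) (≤-antisym l≤k k≤l)

  triangle-fan : ∀ {x m y} → IsTriple (F k) x m y → E x m → E m y → E x y → IsFan E f k k x y
  triangle-fan {k} {x = x} {m} {y} T x→m m→y x→y =
    VertF⁺ ≤-refl ≤-refl a∈S , ¬in , source , VertF⁺ ≤-refl ≤-refl c∈S , ¬out , sink , inner
    where
    open IsTriple T
    ¬in : ∀ u → ¬ EdgeF E f k k u x
    ¬in u u→x∈ with u→x , _ , k≤l , l≤k , u∈ , _ ← EdgeF⁻ u→x∈ with exhaustive (only-face k≤l l≤k u∈)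
    ... | inj₁ refl        = ¬loop u→x
    ... | inj₂ (inj₁ refl) = ¬2-cycle x→m u→x
    ... | inj₂ (inj₂ refl) = ¬2-cycle x→y u→x
    ¬out : ∀ w → ¬ EdgeF E f k k y w
    ¬out w y→w∈ with y→w , _ , k≤l , l≤k , _ , w∈ ← EdgeF⁻ y→w∈ with exhaustive (only-face k≤l l≤k w∈)
    ... | inj₁ refl        = ¬2-cycle x→y y→w
    ... | inj₂ (inj₁ refl) = ¬2-cycle m→y y→w
    ... | inj₂ (inj₂ refl) = ¬loop y→w
    source : ∀ v → VertF E f k k v → (∀ u → ¬ EdgeF E f k k u v) → v ≡ x
    source v v∈ ¬in-v with _ , k≤l , l≤k , v∈l ← VertF⁻ v∈ with exhaustive (only-face k≤l l≤k v∈l)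
    ... | inj₁ v≡x         = v≡x
    ... | inj₂ (inj₁ refl) = ⊥-elim (¬in-v x (EdgeF⁺ x→m ≤-refl ≤-refl a∈S b∈S))
    ... | inj₂ (inj₂ refl) = ⊥-elim (¬in-v x (EdgeF⁺ x→y ≤-refl ≤-refl a∈S c∈S))
    sink : ∀ v → VertF E f k k v → (∀ w → ¬ EdgeF E f k k v w) → v ≡ y
    sink v v∈ ¬out-v with _ , k≤l , l≤k , v∈l ← VertF⁻ v∈ with exhaustive (only-face k≤l l≤k v∈l)
    ... | inj₁ refl        = ⊥-elim (¬out-v y (EdgeF⁺ x→y ≤-refl ≤-refl a∈S c∈S))
    ... | inj₂ (inj₁ refl) = ⊥-elim (¬out-v y (EdgeF⁺ m→y ≤-refl ≤-refl b∈S c∈S))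
    ... | inj₂ (inj₂ v≡y)  = v≡y
    inner : ∀ u v → InnerEdgeF E f k k u v → u ≡ x ⊎ v ≡ x
    inner u v uv∈ with _ , _ , _ , k≤i , i≤k , k≤j , j≤k , i≢j , _ ← InnerEdgeF⁻ uv∈ =
      ⊥-elim (i≢j (trans (≤-antisym i≤k k≤i) (≤-antisym k≤j j≤k)))

  face-fan : k < h → ∃[ x ] ∃[ y ] IsFan E f k k x y
  face-fan {k} k<h = oriented (orient-triangle T (F-Adj a∈S b∈S a≢b) (F-Adj a∈S c∈S a≢c) (F-Adj b∈S c∈S b≢c))
    where
    T = proj₂ (proj₂ (proj₂ (F-triple k<h)))
    open IsTriple T
    oriented : ∃[ x ] ∃[ m ] ∃[ y ] (IsTriple (F k) x m y × E x m × E m y × E x y) →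
               ∃[ x ] ∃[ y ] IsFan E f k k x y
    oriented (x , m , y , T′ , x→m , m→y , x→y) = x , y , triangle-fan T′ x→m m→y x→y

  s∈F₀ : s ∈ F 0
  s∈F₀ = let i , i≡0 , s∈ = s∈f₀ in subst (λ k → s ∈ F k) i≡0 (subst (s ∈_) (sym (F-toℕ i)) s∈)

  apex′≢s : (H : Hinge k) → apex′ H ≢ s
  apex′≢s H r≡s = apex′∉earlier H z≤n (subst (_∈ F 0) (sym r≡s) s∈F₀)

  NoInEdgeUpTo : Fin n → ℕ → Set
  NoInEdgeUpTo z m = ∀ {j p} → j ≤ m → z ∈ F j → p ∈ F j → ¬ E p z

  NoInEdgeUpTo-step : (H : Hinge k) → z ∈ F k → NoInEdgeUpTo z k → E z (apex′ H) → NoInEdgeUpTo z (suc k)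
  NoInEdgeUpTo-step H z∈ no-in z→r j≤1+k z∈j p∈j p→z with m≤n⇒m<n∨m≡n j≤1+k
  ... | inj₁ j<1+k = no-in (s≤s⁻¹ j<1+k) z∈j p∈j p→z
  ... | inj₂ refl with F′-exhaustive H p∈j
  ...   | inj₁ refl        = no-in ≤-refl z∈ (tail∈F H) p→z
  ...   | inj₂ (inj₁ refl) = no-in ≤-refl z∈ (head∈F H) p→z
  ...   | inj₂ (inj₂ refl) = ¬2-cycle z→r p→z

  private
    ¬old→r→z : z ∈ F k → NoInEdgeUpTo z k → p ∈ F k → E p q → E q z → ⊥
    ¬old→r→z {z = z} {p = p} z∈ no-in p∈ p→q q→z with p Fin.≟ z
    ... | yes refl = ¬2-cycle p→q q→z
    ... | no  p≢z  = ¬3-cycle p→q q→z (Adj-reverse (F-Adj p∈ z∈ p≢z) (no-in ≤-refl z∈ p∈))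

  NoInEdgeUpTo-apex′ : (H : Hinge k) → z ∈ F k → NoInEdgeUpTo z k → E (apex′ H) z →
                       NoInEdgeUpTo (apex′ H) (suc k)
  NoInEdgeUpTo-apex′ H z∈ no-in r→z j≤1+k r∈j p∈j p→r with m≤n⇒m<n∨m≡n j≤1+k
  ... | inj₁ j<1+k = apex′∉earlier H (s≤s⁻¹ j<1+k) r∈j
  ... | inj₂ refl with F′-exhaustive H p∈j
  ...   | inj₁ refl        = ¬old→r→z z∈ no-in (tail∈F H) p→r r→z
  ...   | inj₂ (inj₁ refl) = ¬old→r→z z∈ no-in (head∈F H) p→r r→z
  ...   | inj₂ (inj₂ refl) = ¬loop p→r

  -- The in-edge of z ≠ s must come from a later face; then z or the next apex again has no
  -- in-edge in the prefix one face longer, which cannot go on past the last face.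
  ¬NoInEdgeUpTo : ∀ d {k z} → k + d ≡ h → z ∈ F k → z ≢ s → ¬ NoInEdgeUpTo z k
  ¬NoInEdgeUpTo zero {k} k≡h z∈ _ _ = <-irrefl (trans (sym (+-identityʳ k)) k≡h) (∈F⇒<h z∈)
  ¬NoInEdgeUpTo (suc d) {k} {z} k+d≡h z∈ z≢s no-in =
    z≢s (proj₁ (proj₂ (proj₂ st-dag)) z λ p p→z → in-edge p→z (edge-on-face p→z))
    where
    1+k+d≡h = trans (sym (+-suc k d)) k+d≡h
    in-edge : ∀ {p} → E p z → ∃[ l ] (p ∈ F l × z ∈ F l) → ⊥
    in-edge p→z (l , p∈ , z∈l) with l ≤? k
    ... | yes l≤k = no-in l≤k z∈l p∈ p→z
    ... | no  l≰k = towards (F-Dec z∈′ (apex′∈F′ H))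
      where
      k<l = ≰⇒> l≰k
      H = hinge (≤-<-trans k<l (∈F⇒<h p∈))
      z∈′ = proj₂ (∈F-interval z∈ z∈l ≤-refl k<l)
      towards : Dec (E z (apex′ H)) → ⊥
      towards (yes z→r) = ¬NoInEdgeUpTo d 1+k+d≡h z∈′ z≢s (NoInEdgeUpTo-step H z∈ no-in z→r)
      towards (no ¬z→r) =
        ¬NoInEdgeUpTo d 1+k+d≡h (apex′∈F′ H) (apex′≢s H)
          (NoInEdgeUpTo-apex′ H z∈ no-in (Adj-reverse (F-Adj z∈′ (apex′∈F′ H) (∈∉⇒≢ z∈ (apex′∉F H))) ¬z→r))

  -- such an edge would make the apex a source of the prefix ending at its face
  ¬apex′→tail : (H : Hinge k) → ¬ E (apex′ H) (tail H)
  ¬apex′→tail {k} H r→u =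
    ¬NoInEdgeUpTo (h ∸ suc k) (m+[n∸m]≡n (<⇒≤ (hinge⇒<h H))) (apex′∈F′ H) (apex′≢s H) no-in
    where
    no-in : NoInEdgeUpTo (apex′ H) (suc k)
    no-in j≤1+k r∈j p∈j p→r with m≤n⇒m<n∨m≡n j≤1+k
    ... | inj₁ j<1+k = apex′∉earlier H (s≤s⁻¹ j<1+k) r∈j
    ... | inj₂ refl with F′-exhaustive H p∈j
    ...   | inj₁ refl        = ¬2-cycle p→r r→u
    ...   | inj₂ (inj₁ refl) = ¬3-cycle (tail→head H) p→r r→u
    ...   | inj₂ (inj₂ refl) = ¬loop p→r

  fan-source∈first : a ≤ c → c < h → IsFan E f a c x y → x ∈ F a
  fan-source∈first {a} {c} {x} a≤c c<h (x∈ , _ , _ , _ , _ , _ , inner) with a <? c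
  ... | no a≮c = let _ , a≤k , k≤c , x∈k = VertF⁻ x∈
                 in subst (λ k → x ∈ F k) (≤-antisym (≤-trans k≤c (≮⇒≥ a≮c)) a≤k) x∈k
  ... | yes a<c = incident (inner _ _ (InnerEdgeF⁺ (tail→head H) ≤-refl (<⇒≤ a<c) (n≤1+n a) a<c
                                        (λ a≡1+a → <-irrefl a≡1+a (n<1+n a))
                                        (tail∈F H) (head∈F H) (tail∈F′ H) (head∈F′ H)))
    where
    H = hinge (≤-<-trans a<c c<h)
    incident : tail H ≡ x ⊎ head H ≡ x → x ∈ F a
    incident (inj₁ refl) = tail∈F H
    incident (inj₂ refl) = head∈F H

  fan-source≡tail : (H : Hinge b) → suc b ≤ c → c < h → IsFan E f (suc b) c x y → x ≡ tail H
  fan-source≡tail H 1+b≤c c<h fan@(_ , ¬in , _) with F′-exhaustive H (fan-source∈first 1+b≤c c<h fan)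
  ... | inj₁ x≡u = x≡u
  ... | inj₂ (inj₁ refl) = ⊥-elim (¬in _ (EdgeF⁺ (tail→head H) ≤-refl 1+b≤c (tail∈F′ H) (head∈F′ H)))
  ... | inj₂ (inj₂ refl) with F-Dec (tail∈F′ H) (apex′∈F′ H)
  ...   | yes u→r = ⊥-elim (¬in _ (EdgeF⁺ u→r ≤-refl 1+b≤c (tail∈F′ H) (apex′∈F′ H)))
  ...   | no ¬u→r = ⊥-elim (¬apex′→tail H (Adj-reverse (tail-apex′ H) ¬u→r))

  private
    module Extension {a b} (H : Hinge b) (a≤b : a ≤ b) (fan : IsFan E f a b (tail H) (head H))
                     (u→r : E (tail H) (apex′ H)) where

      u = tail H
      v = head H
      r = apex′ H
      u→v = tail→head H

      u∈old      = proj₁ fan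
      ¬in-old    = proj₁ (proj₂ fan)
      source-old = proj₁ (proj₂ (proj₂ fan))
      v∈old      = proj₁ (proj₂ (proj₂ (proj₂ fan)))
      ¬out-old   = proj₁ (proj₂ (proj₂ (proj₂ (proj₂ fan))))
      sink-old   = proj₁ (proj₂ (proj₂ (proj₂ (proj₂ (proj₂ fan)))))
      inner-old  = proj₂ (proj₂ (proj₂ (proj₂ (proj₂ (proj₂ fan)))))

      a≤1+b : a ≤ suc b
      a≤1+b = ≤-trans a≤b (n≤1+n b)

      new-edge : E x y → x ∈ F (suc b) → y ∈ F (suc b) → EdgeF E f a (suc b) x y
      new-edge x→y = EdgeF⁺ x→y a≤1+b ≤-refl

      ¬in : ∀ p → ¬ EdgeF E f a (suc b) p u
      ¬in p p→u∈ with EdgeF-split p→u∈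
      ... | inj₁ old = ¬in-old p old
      ... | inj₂ (p→u , p∈ , _) with F′-exhaustive H p∈
      ...   | inj₁ refl        = ¬loop p→u
      ...   | inj₂ (inj₁ refl) = ¬2-cycle u→v p→u
      ...   | inj₂ (inj₂ refl) = ¬2-cycle u→r p→u

      source : ∀ w → VertF E f a (suc b) w → (∀ p → ¬ EdgeF E f a (suc b) p w) → w ≡ u
      source w w∈ ¬in-w with VertF-split w∈
      ... | inj₁ old = source-old w old (λ p → ¬in-w p ∘ EdgeF-weaken (n≤1+n b))
      ... | inj₂ w∈′ with F′-exhaustive H w∈′
      ...   | inj₁ w≡u         = w≡u
      ...   | inj₂ (inj₁ refl) = ⊥-elim (¬in-w u (new-edge u→v (tail∈F′ H) (head∈F′ H)))
      ...   | inj₂ (inj₂ refl) = ⊥-elim (¬in-w u (new-edge u→r (tail∈F′ H) (apex′∈F′ H)))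

      across : E x y → k < suc b → x ∈ F k → y ∈ F k → x ∈ F (suc b) → y ∈ F (suc b) → x ≡ u ⊎ y ≡ u
      across x→y k<1+b x∈ y∈ x∈′ y∈′ with shared-edge⇒consecutive k<1+b x→y x∈ y∈ x∈′ y∈′
      ... | refl with shared⇒tail-or-head H x∈ x∈′ | shared⇒tail-or-head H y∈ y∈′
      ...   | inj₁ x≡u  | _         = inj₁ x≡u
      ...   | inj₂ _    | inj₁ y≡u  = inj₂ y≡u
      ...   | inj₂ refl | inj₂ refl = ⊥-elim (¬loop x→y)

      inner : ∀ x y → InnerEdgeF E f a (suc b) x y → x ≡ u ⊎ y ≡ u
      inner x y e with x→y , k , l , a≤k , k≤1+b , a≤l , l≤1+b , k≢l , x∈k , y∈k , x∈l , y∈l ← InnerEdgeF⁻ e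
                  with m≤n⇒m<n∨m≡n k≤1+b | m≤n⇒m<n∨m≡n l≤1+b
      ... | inj₁ k<1+b | inj₁ l<1+b =
        inner-old x y
          (InnerEdgeF⁺ x→y a≤k (s≤s⁻¹ k<1+b) a≤l (s≤s⁻¹ l<1+b) k≢l x∈k y∈k x∈l y∈l)
      ... | inj₁ k<1+b | inj₂ refl  = across x→y k<1+b x∈k y∈k x∈l y∈l
      ... | inj₂ refl  | inj₁ l<1+b = across x→y l<1+b x∈l y∈l x∈k y∈k
      ... | inj₂ refl  | inj₂ refl  = ⊥-elim (k≢l refl)

      to-apex′ : E v r → IsFan E f a (suc b) u r
      to-apex′ v→r = VertF-weaken (n≤1+n b) u∈old , ¬in , source ,
                     VertF⁺ a≤1+b ≤-refl (apex′∈F′ H) , ¬out , sink , inner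
        where
        ¬out : ∀ q → ¬ EdgeF E f a (suc b) r q
        ¬out q r→q∈ with EdgeF-split r→q∈
        ... | inj₁ old = let _ , _ , _ , k≤b , r∈k , _ = EdgeF⁻ old in apex′∉earlier H k≤b r∈k
        ... | inj₂ (r→q , _ , q∈) with F′-exhaustive H q∈
        ...   | inj₁ refl        = ¬2-cycle u→r r→q
        ...   | inj₂ (inj₁ refl) = ¬2-cycle v→r r→q
        ...   | inj₂ (inj₂ refl) = ¬loop r→q
        sink : ∀ w → VertF E f a (suc b) w → (∀ q → ¬ EdgeF E f a (suc b) w q) → w ≡ r
        sink w w∈ ¬out-w with VertF-split w∈
        ... | inj₁ old with refl ← sink-old w old (λ q → ¬out-w q ∘ EdgeF-weaken (n≤1+n b))
          = ⊥-elim (¬out-w r (new-edge v→r (head∈F′ H) (apex′∈F′ H)))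
        ... | inj₂ w∈′ with F′-exhaustive H w∈′
        ...   | inj₁ refl        = ⊥-elim (¬out-w v (new-edge u→v (tail∈F′ H) (head∈F′ H)))
        ...   | inj₂ (inj₁ refl) = ⊥-elim (¬out-w r (new-edge v→r (head∈F′ H) (apex′∈F′ H)))
        ...   | inj₂ (inj₂ w≡r)  = w≡r

      to-head : E r v → IsFan E f a (suc b) u v
      to-head r→v = VertF-weaken (n≤1+n b) u∈old , ¬in , source ,
                    VertF-weaken (n≤1+n b) v∈old , ¬out , sink , inner
        where
        ¬out : ∀ q → ¬ EdgeF E f a (suc b) v q
        ¬out q v→q∈ with EdgeF-split v→q∈
        ... | inj₁ old = ¬out-old q old
        ... | inj₂ (v→q , _ , q∈) with F′-exhaustive H q∈
        ...   | inj₁ refl        = ¬2-cycle u→v v→q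
        ...   | inj₂ (inj₁ refl) = ¬loop v→q
        ...   | inj₂ (inj₂ refl) = ¬2-cycle r→v v→q
        sink : ∀ w → VertF E f a (suc b) w → (∀ q → ¬ EdgeF E f a (suc b) w q) → w ≡ v
        sink w w∈ ¬out-w with VertF-split w∈
        ... | inj₁ old = sink-old w old (λ q → ¬out-w q ∘ EdgeF-weaken (n≤1+n b))
        ... | inj₂ w∈′ with F′-exhaustive H w∈′
        ...   | inj₁ refl        = ⊥-elim (¬out-w v (new-edge u→v (tail∈F′ H) (head∈F′ H)))
        ...   | inj₂ (inj₁ w≡v)  = w≡v
        ...   | inj₂ (inj₂ refl) = ⊥-elim (¬out-w v (new-edge r→v (apex′∈F′ H) (head∈F′ H)))

  fan-extend : (H : Hinge b) → a ≤ b → IsFan E f a b (tail H) (head H) → E (tail H) (apex′ H) →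
               ∃[ x ] ∃[ y ] IsFan E f a (suc b) x y
  fan-extend H a≤b fan u→r with F-Dec (head∈F′ H) (apex′∈F′ H)
  ... | yes v→r = _ , _ , Extension.to-apex′ H a≤b fan u→r v→r
  ... | no ¬v→r = _ , _ , Extension.to-head H a≤b fan u→r
                            (Adj-reverse (head-apex′ H) ¬v→r)

  maximal-fan-edge : (H : Hinge b) → a ≤ b → IsFan E f a b x y → IncMax E f a b → ¬ (tail H ≡ x × head H ≡ y)
  maximal-fan-edge H a≤b fan (inj₁ 1+b≡h) _ = <-irrefl 1+b≡h (hinge⇒<h H)
  maximal-fan-edge H a≤b fan (inj₂ ¬fan) (refl , refl) with F-Dec (tail∈F′ H) (apex′∈F′ H)
  ... | yes u→r = ¬fan (fan-extend H a≤b fan u→r)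
  ... | no ¬u→r = ¬apex′→tail H (Adj-reverse (tail-apex′ H) ¬u→r)

  record MaximalFan (a : ℕ) : Set where
    field
      end : ℕ
      source sink : Fin n
      a≤end : a ≤ end
      end<h : end < h
      fan : IsFan E f a end source sink
      maximal : IncMax E f a end

  private
    grow : ∀ d {b x y} → suc (b + d) ≡ h → a ≤ b → IsFan E f a b x y → MaximalFan a
    grow zero {b} {x} {y} 1+b+0≡h a≤b fan = record
      { end = b ; source = x ; sink = y ; a≤end = a≤b ; end<h = subst (b <_) 1+b≡h (n<1+n b) ; fan = fan
      ; maximal = inj₁ 1+b≡h }
      where 1+b≡h = trans (cong suc (sym (+-identityʳ b))) 1+b+0≡h
    grow {a} (suc d) {b} 1+b+d≡h a≤b fan with Fan? a (suc b)
    ... | yes (_ , _ , fan′) = grow d (trans (cong suc (sym (+-suc b d))) 1+b+d≡h) (≤-trans a≤b (n≤1+n b)) fan′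
    ... | no  ¬fan′          = record
      { end = b ; source = _ ; sink = _ ; a≤end = a≤b ; end<h = subst (b <_) 1+b+d≡h (s≤s (m≤m+n b (suc d)))
      ; fan = fan ; maximal = inj₂ ¬fan′ }

  maximal-fan : a < h → MaximalFan a
  maximal-fan {a} a<h = let _ , _ , fan = face-fan a<h in grow (h ∸ suc a) (m+[n∸m]≡n a<h) ≤-refl fan

  -- fan i starts right after fan i - 1 ends and is as long as possible (junk values past the last face)
  private
    fan-from : ∀ a → Dec (a < h) → ℕ × Fin n × Fin n
    fan-from a (yes a<h) = let open MaximalFan (maximal-fan a<h) in end , source , sink
    fan-from a (no _)    = a , s , s

    end-of : ℕ → ℕ
    end-of a = proj₁ (fan-from a (a <? h))

    ≤end-of : ∀ a → a ≤ end-of a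
    ≤end-of a with a <? h
    ... | yes a<h = MaximalFan.a≤end (maximal-fan a<h)
    ... | no  _   = ≤-refl

  lo : ℕ → ℕ
  lo zero    = 0
  lo (suc i) = suc (end-of (lo i))

  hi : ℕ → ℕ
  hi i = end-of (lo i)

  src snk : ℕ → Fin n
  src i = proj₁ (proj₂ (fan-from (lo i) (lo i <? h)))
  snk i = proj₂ (proj₂ (fan-from (lo i) (lo i <? h)))

  lo≤hi : ∀ i → lo i ≤ hi i
  lo≤hi i = ≤end-of (lo i)

  private
    MaximalFanAt : ℕ → ℕ × Fin n × Fin n → Set
    MaximalFanAt a (b , x , y) = b < h × IsFan E f a b x y × IncMax E f a b

    fan-from-maximal : ∀ a (a<h? : Dec (a < h)) → a < h → MaximalFanAt a (fan-from a a<h?)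
    fan-from-maximal a (yes a<h) _ = let open MaximalFan (maximal-fan a<h) in end<h , fan , maximal
    fan-from-maximal a (no a≮h) a<h = ⊥-elim (a≮h a<h)

  lo-mono : i ≤ j → lo i ≤ lo j
  lo-mono {i} {j} i≤j = subst (λ k → lo i ≤ lo k) (m∸n+n≡m i≤j) (lo-+ (j ∸ i))
    where
    lo-+ : ∀ d → lo i ≤ lo (d + i)
    lo-+ zero    = ≤-refl
    lo-+ (suc d) = ≤-trans (lo-+ d) (≤-trans (lo≤hi (d + i)) (n≤1+n _))

  i≤lo : ∀ i → i ≤ lo i
  i≤lo zero    = z≤n
  i≤lo (suc i) = s≤s (≤-trans (i≤lo i) (lo≤hi i))

  private
    last-fan : ∃[ i ] (h ≤ suc (hi i) × ∀ {j} → j < i → ¬ h ≤ suc (hi j))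
    last-fan = least (λ i → h ≤? suc (hi i)) (≤-trans (i≤lo h) (≤-trans (lo≤hi h) (n≤1+n _)))

  K : ℕ
  K = suc (proj₁ last-fan)

  lo<h : i < K → lo i < h
  lo<h {zero}  _     = let i , i≡0 , _ = s∈f₀ in subst (_< h) i≡0 (Fin.toℕ<n i)
  lo<h {suc i} 1+i<K = ≰⇒> (proj₂ (proj₂ last-fan) (s≤s⁻¹ 1+i<K))

  fan-at : i < K → MaximalFanAt (lo i) (hi i , src i , snk i)
  fan-at {i} i<K = fan-from-maximal (lo i) (lo i <? h) (lo<h i<K)

  private
    ≤last-hi : k < h → k ≤ hi (proj₁ last-fan)
    ≤last-hi k<h = s≤s⁻¹ (≤-trans k<h (proj₁ (proj₂ last-fan)))

  locate : k < h → ∃[ i ] (i < K × lo i ≤ k × k ≤ hi i)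
  locate {k} k<h with least (λ i → k ≤? hi i) (≤last-hi k<h)
  ... | i , k≤hi , below = i , s≤s (≮⇒≥ λ i₀<i → below i₀<i (≤last-hi k<h)) , lo≤k i below , k≤hi
    where
    lo≤k : ∀ i → (∀ {j} → j < i → ¬ k ≤ hi j) → lo i ≤ k
    lo≤k zero    _     = z≤n
    lo≤k (suc i) below = ≰⇒> (below ≤-refl)

  fans-apart : suc i < j → ¬ (EdgeF E f (lo i) (hi i) x y × EdgeF E f (lo j) (hi j) x y)
  fans-apart {i} {j} 1+i<j (e₁ , e₂) =
    let x→y , k , _ , k≤hi , x∈k , y∈k = EdgeF⁻ e₁
        _ , l , lo≤l , _ , x∈l , y∈l = EdgeF⁻ e₂
        2+k≤l = ≤-trans (s≤s (s≤s k≤hi)) (≤-trans (s≤s (lo≤hi (suc i))) (≤-trans (lo-mono 1+i<j) lo≤l))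
    in <-irrefl (sym (shared-edge⇒consecutive (≤-trans (n≤1+n _) 2+k≤l) x→y x∈k y∈k x∈l y∈l)) 2+k≤l

  consecutive-fans : suc i < K → ∃[ x ] ∃[ y ] (SharedExactly E f (lo i) (hi i) (lo (suc i)) (hi (suc i)) x y
                                               × x ≡ src (suc i) × ¬ (x ≡ src i × y ≡ snk i))
  consecutive-fans {i} 1+i<K =
    tail H , head H , (in-i , in-1+i , only-hinge-edge) ,
    sym (fan-source≡tail H (lo≤hi (suc i)) (proj₁ (fan-at 1+i<K)) (proj₁ (proj₂ (fan-at 1+i<K)))) ,
    maximal-fan-edge H (lo≤hi i) (proj₁ (proj₂ (fan-at i<K))) (proj₂ (proj₂ (fan-at i<K)))
    where
    i<K = <-trans (n<1+n i) 1+i<K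
    H = hinge (lo<h 1+i<K)
    in-i = EdgeF⁺ (tail→head H) (lo≤hi i) ≤-refl (tail∈F H) (head∈F H)
    in-1+i = EdgeF⁺ (tail→head H) ≤-refl (lo≤hi (suc i)) (tail∈F′ H) (head∈F′ H)
    only-hinge-edge : ∀ x y → EdgeF E f (lo i) (hi i) x y → EdgeF E f (lo (suc i)) (hi (suc i)) x y →
                      x ≡ tail H × y ≡ head H
    only-hinge-edge x y e₁ e₂ with x→y , k , _ , k≤hi , x∈k , y∈k ← EdgeF⁻ e₁
                               | _ , l , 1+hi≤l , _ , x∈l , y∈l ← EdgeF⁻ e₂
                               with shared-edge⇒consecutive (≤-trans (s≤s k≤hi) 1+hi≤l) x→y x∈k y∈k x∈l y∈l
    ... | refl with refl ← ≤-antisym k≤hi (s≤s⁻¹ 1+hi≤l) = shared-edge⇒hinge-edge H x→y x∈k y∈k x∈l y∈l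

  src₀≡s : src 0 ≡ s
  src₀≡s = let _ , (_ , _ , unique-source , _) , _ = fan-at {0} (s≤s z≤n) in
    sym (unique-source s (VertF⁺ z≤n z≤n s∈F₀) λ u e → proj₁ (proj₂ st-dag) u (proj₁ (EdgeF⁻ e)))

  decomposition : FanDecomposition E f s
  decomposition = record
    { k = K ; lo = lo ; hi = hi ; src = src ; snk = snk
    ; lo≤hi = λ i _ → lo≤hi i
    ; hi<h = λ _ i<K → proj₁ (fan-at i<K)
    ; fan = λ _ i<K → proj₁ (proj₂ (fan-at i<K))
    ; maximal = λ _ i<K → proj₂ (proj₂ (fan-at i<K))
    ; noShare = λ _ _ _ 1+i<j _ _ → fans-apart 1+i<j
    ; consecutive = λ _ → consecutive-fans
    ; nonEmpty = s≤s z≤n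
    ; firstSrc = src₀≡s
    ; coverV = λ v → let k , v∈ = vertex-on-face v ; i , i<K , lo≤k , k≤hi = locate (∈F⇒<h v∈)
                     in i , i<K , VertF⁺ lo≤k k≤hi v∈
    ; coverE = λ u v u→v → let k , u∈ , v∈ = edge-on-face u→v ; i , i<K , lo≤k , k≤hi = locate (∈F⇒<h u∈)
                           in i , i<K , EdgeF⁺ u→v lo≤k k≤hi u∈ v∈
    }

lemma4 : (n : ℕ) (E : Fin n → Fin n → Set) (s t : Fin n) (pos : Fin n → Fin n)
    → STDAG E s t
    → OuterplanarDrawing pos E
    → Biconnected E
    → InternallyTriangulated pos E
    → (h : ℕ) (f : Fin h → Subset n)
    → FaceOrdering pos E h f
    → (∃[ i ] (toℕ i ≡ 0 × s ∈ f i))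
    → FanDecomposition E f s
lemma4 n E s t pos st-dag drawing biconnected triangulated h f ordering s∈f₀ =
  Decomposition.decomposition st-dag drawing biconnected triangulated ordering s∈f₀
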